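{- Let $r\ge4$ be an integer and let $s\in\{1,\dots,r-1\}$. The matroid obtained from the Kinser matroid $\mathrm{Kin}(r)$ by relaxing the circuit-hyperplane $H_s\cup H_r$ is not representable over any field.
   Context: Kinser matroids. Let $r\ge4$ be an integer. Let $H_1,\dots,H_r$ be pairwise disjoint sets with $|H_1|=\cdots=|H_{r-1}|=r-2$ and $H_r=\{e,f\}$, and let $E=H_1\cup\cdots\cup H_r$. Let $\mathcal{A}=E$, $\mathcal{A}'=H_r$, and for $i\in\{1,\dots,r-1\}$ let $\mathcal{A}_i=(H_1\cup\cdots\cup H_{r-1})-(H_{i-1}\cup H_i)$, where subscripts are interpreted modulo $r-1$ (so $H_0=H_{r-1}$). Let $M_{r+1}$ be the transversal matroid $M[\mathcal{A}_1,\dots,\mathcal{A}_{r-1},\mathcal{A},\mathcal{A}']$ on $E$ (its independent sets are the partial transversals of this family of $r+1$ sets); it has rank $r+1$. The Kinser matroid $\mathrm{Kin}(r)$ is the truncation of $M_{r+1}$, i.e. the matroid on $E$ whose independent sets are the independent sets of $M_{r+1}$ of size at most $r$. For every $s\in\{1,\dots,r-1\}$ the set $H_s\cup H_r$ is a circuit-hyperplane of $\mathrm{Kin}(r)$. Relaxing a circuit-hyperplane $X$ of a matroid means forming the matroid whose bases are the bases of the original matroid together with $X$. -}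

module Defs where

open import Level using (Level; _⊔_; suc)
open import Data.Nat as ℕ using (ℕ; _∸_; _≤_)
open import Data.Fin as Fin using (Fin; toℕ; splitAt; remQuot)
open import Data.Fin.Subset using (Subset; _∈_; _∉_; _⊆_; ∣_∣)
open import Data.Vec using (tabulate)
open import Data.Bool using (Bool; true; false)
open import Data.Sum using (_⊎_; inj₁; inj₂)
open import Data.Product using (Σ; ∃; _×_; _,_; proj₁)
open import Relation.Binary.PropositionalEquality using (_≡_; _≢_)
open import Relation.Nullary using (¬_; does)
open import Algebra.Bundles using (CommutativeRing)

record Field (c ℓ : Level) : Set (suc (c ⊔ ℓ)) where
  field
    commutativeRing : CommutativeRing c ℓ
  open CommutativeRing commutativeRing public
  field
    0≉1     : ¬ (0# ≈ 1#)
    inverse : ∀ x → ¬ (x ≈ 0#) → Σ Carrier λ y → (x * y) ≈ 1#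

module _ {c ℓ} (F : Field c ℓ) where
  open Field F

  ∑ : ∀ {N} → (Fin N → Carrier) → Carrier
  ∑ {ℕ.zero}  f = 0#
  ∑ {ℕ.suc N} f = f Fin.zero + ∑ (λ i → f (Fin.suc i))

  LinIndep : ∀ {N n} → (Fin N → Fin n → Carrier) → Subset N → Set (c ⊔ ℓ)
  LinIndep {N} φ X =
    (γ : Fin N → Carrier) →
    (∀ x → x ∉ X → γ x ≈ 0#) →
    (∀ j → ∑ (λ x → γ x * φ x j) ≈ 0#) →
    ∀ x → γ x ≈ 0#

  Representable : ∀ {N} → (Subset N → Set) → Set (c ⊔ ℓ)
  Representable {N} I =
    Σ ℕ λ n → Σ (Fin N → Fin n → Carrier) λ φ →
      ∀ X → (I X → LinIndep φ X) × (LinIndep φ X → I X)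

RelaxBasis : ∀ {N} → ℕ → (Subset N → Set) → Subset N → Subset N → Set
RelaxBasis r I X B = (I B × ∣ B ∣ ≡ r) ⊎ (B ≡ X)

RelaxIndep : ∀ {N} → ℕ → (Subset N → Set) → Subset N → Subset N → Set
RelaxIndep r I X Y = ∃ λ B → RelaxBasis r I X B × Y ⊆ B

PartialTransversal : ∀ {N} {Idx : Set} → (Idx → Fin N → Set) → Subset N → Set
PartialTransversal {N} {Idx} A X =
  Σ (Fin N → Idx) λ σ →
    (∀ x → x ∈ X → A (σ x) x) ×
    (∀ x y → x ∈ X → y ∈ X → σ x ≡ σ y → x ≡ y)

-- Ground set E = Fin (kinN r), kinN r = (r-1)(r-2) + 2.
-- An element decodes (block) to inj₁ (k , t) : it is the t-th element of
-- H_{k+1} (k : Fin (r-1), t : Fin (r-2)), or to inj₂ t : the element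
-- e (t = 0) or f (t = 1) of H_r.

kinN : ℕ → ℕ
kinN r = (r ∸ 1) ℕ.* (r ∸ 2) ℕ.+ 2

block : ∀ r → Fin (kinN r) → (Fin (r ∸ 1) × Fin (r ∸ 2)) ⊎ Fin 2
block r x with splitAt ((r ∸ 1) ℕ.* (r ∸ 2)) x
... | inj₁ y = inj₁ (remQuot (r ∸ 2) y)
... | inj₂ t = inj₂ t

-- (0-based) cyclic adjacency: H_{j} is H_{(k+1)-1 mod (r-1)}, i.e.
-- k is the cyclic predecessor of j in Fin (r-1).
CycPred : ∀ r → Fin (r ∸ 1) → Fin (r ∸ 1) → Set
CycPred r k j = (toℕ j ≡ ℕ.suc (toℕ k)) ⊎ (toℕ j ≡ 0 × ℕ.suc (toℕ k) ≡ r ∸ 1)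

-- Index set of the family (r+1 sets):
--   inj₁ j  ↦ 𝒜_{j+1} = (H_1 ∪ … ∪ H_{r-1}) - (H_j ∪ H_{j+1})   (1-based, mod r-1)
--   inj₂ 0  ↦ 𝒜  = E
--   inj₂ 1  ↦ 𝒜' = H_r
KinIdx : ℕ → Set
KinIdx r = Fin (r ∸ 1) ⊎ Fin 2

KinFamily : ∀ r → KinIdx r → Fin (kinN r) → Set
KinFamily r (inj₁ j) x with block r x
... | inj₁ (k , _) = (k ≢ j) × ¬ CycPred r k j
... | inj₂ _       = Data.Empty.⊥
  where import Data.Empty
KinFamily r (inj₂ Fin.zero) x = Data.Unit.⊤
  where import Data.Unit
KinFamily r (inj₂ (Fin.suc _)) x with block r x
... | inj₁ _ = Data.Empty.⊥
  where import Data.Empty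
... | inj₂ _ = Data.Unit.⊤
  where import Data.Unit

-- M_{r+1} = M[𝒜_1,…,𝒜_{r-1},𝒜,𝒜'] and its truncation Kin(r)
M-Indep : ∀ r → Subset (kinN r) → Set
M-Indep r X = PartialTransversal (KinFamily r) X

Kin-Indep : ∀ r → Subset (kinN r) → Set
Kin-Indep r X = M-Indep r X × ∣ X ∣ ≤ r

-- H_s ∪ H_r for s : Fin (r-1) (0-based: s ↦ H_{s+1})
inHsHr : ∀ r → Fin (r ∸ 1) → Fin (kinN r) → Bool
inHsHr r s x with block r x
... | inj₁ (k , _) = does (k Fin.≟ s)
... | inj₂ _       = true

HsHr : ∀ r → Fin (r ∸ 1) → Subset (kinN r)
HsHr r s = tabulate (inHsHr r s)

KinRelax-Indep : ∀ r → Fin (r ∸ 1) → Subset (kinN r) → Set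
KinRelax-Indep r s = RelaxIndep r (Kin-Indep r) (HsHr r s)

module Submission where

-- Suppose φ represents the relaxation of Kin(r) at H_s ∪ H_r, and write ⟨a,b⟩ = a·φ(e) + b·φ(f).
-- For each block i ≠ s, H_i ∪ {e, f} is a circuit, so span H_i contains a nonzero ⟨a,b⟩.
-- For cyclically consecutive blocks, H_i ∪ {x} spans H_{i+1} for every x ∈ H_{i+1} while
-- H_i ∪ {x, e} is a basis; hence span H_i and span H_{i+1} meet the plane of e and f in the
-- same line. Walking round the cycle from H_{s+1} to H_{s-1} puts one nonzero ⟨a,b⟩ into
-- span(H_s ∪ {y}) ∩ span(H_s ∪ {x}) = span H_s for x ∈ H_{s-1}, y ∈ H_{s+1} (as H_s ∪ {x, y}
-- is a basis), which contradicts H_s ∪ {e, f} being a basis of the relaxation.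
-- Equality in the field need not be decidable, so the linear algebra is carried out in the
-- double-negation monad; that is enough to refute a representation.

open import Defs
open import Level using (Level; _⊔_; 0ℓ)
open import Function using (_∘_)
open import Data.Nat using (ℕ; zero; suc; _≤_; _<_; _∸_; z≤n; s≤s)
import Data.Nat.Properties as ℕ
open import Data.Fin using (Fin; zero; suc; _≟_; splitAt; join; remQuot; combine; _↑ˡ_; _↑ʳ_; punchIn; punchOut)
  renaming (_<_ to _<ᶠ_)
import Data.Fin.Properties as Fin
import Data.Fin.Subset as Subset
open import Data.Fin.Subset using (Subset; ∣_∣) renaming (_∈_ to _∈ₛ_; _⊆_ to _⊆ₛ_)
open import Data.Vec using (tabulate)
import Data.Vec.Properties as Vec
open import Data.Bool using (Bool; true; false; _∨_)
import Data.Bool.Properties as Bool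
open import Data.Sum using (_⊎_; inj₁; inj₂; [_,_]′)
import Data.Sum as Sum
import Data.Sum.Properties as Sum
open import Data.Product using (∃; _×_; _,_; proj₁; proj₂)
open import Data.Empty using (⊥; ⊥-elim)
open import Data.Unit using (tt)
open import Relation.Nullary using (¬_; Dec; yes; no; does; ¬?)
open import Relation.Nullary.Decidable using (_×-dec_; dec-true; dec-false)
open import Relation.Nullary.Decidable.Core using (¬¬-excluded-middle)
open import Relation.Nullary.Negation.Core using (¬¬-map)
open import Relation.Unary using (Pred; Decidable; _∈_; _∉_; _⊆_; _∪_; _∩_; ∁; ｛_｝)
open import Relation.Unary.Properties using (_∪?_; _∩?_; ∁?)
open import Relation.Binary.PropositionalEquality as ≡ using (_≡_; _≢_)

infixl 1 _>>=_

_>>=_ : ∀ {a b} {A : Set a} {B : Set b} → ¬ ¬ A → (A → ¬ ¬ B) → ¬ ¬ B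
(¬¬a >>= k) ¬b = ¬¬a (λ a → k a ¬b)

return : ∀ {a} {A : Set a} → A → ¬ ¬ A
return a ¬a = ¬a a

¬¬-∀ : ∀ {p} N {P : Pred (Fin N) p} → (∀ x → ¬ ¬ P x) → ¬ ¬ (∀ x → P x)
¬¬-∀ zero    _ = return (λ ())
¬¬-∀ (suc N) h = do
  p₀ ← h zero
  pₛ ← ¬¬-∀ N (h ∘ suc)
  return λ { zero → p₀ ; (suc x) → pₛ x }

module LinearAlgebra {c ℓ} (F : Field c ℓ) where
  open Field F hiding (zero)
  open import Algebra.Properties.Semiring.Sum semiring
    using (sum; sum-cong-≋; sum-remove; sum-replicate-zero; ∑-distrib-+; ∑-comm; *-distribˡ-sum; *-distribʳ-sum)
  open import Algebra.Properties.Ring ring using (-‿distribˡ-*; -‿distribʳ-*)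
  open import Algebra.Properties.Group +-group
    using (inverseʳ-unique; x∙y⁻¹≈ε⇒x≈y; ε⁻¹≈ε; ⁻¹-involutive)
  open import Algebra.Properties.AbelianGroup +-abelianGroup using (⁻¹-∙-comm)
  open import Algebra.Solver.Ring.NaturalCoefficients.Default commutativeSemiring
  open import Relation.Binary.Reasoning.Setoid setoid

  recip : ∀ x → x ≉ 0# → Carrier
  recip x x≉0 = proj₁ (inverse x x≉0)

  *-recipʳ : ∀ x (x≉0 : x ≉ 0#) → x * recip x x≉0 ≈ 1#
  *-recipʳ x x≉0 = proj₂ (inverse x x≉0)

  *-recipˡ : ∀ x (x≉0 : x ≉ 0#) → recip x x≉0 * x ≈ 1#
  *-recipˡ x x≉0 = trans (*-comm _ _) (*-recipʳ x x≉0)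

  1≉0 : 1# ≉ 0#
  1≉0 = 0≉1 ∘ sym

  x*y≈0⇒x≈0 : ∀ x y → y ≉ 0# → x * y ≈ 0# → x ≈ 0#
  x*y≈0⇒x≈0 x y y≉0 xy≈0 = begin
    x                      ≈⟨ sym (*-identityʳ x) ⟩
    x * 1#                 ≈⟨ *-congˡ (sym (*-recipʳ y y≉0)) ⟩
    x * (y * recip y y≉0)  ≈⟨ sym (*-assoc x y _) ⟩
    x * y * recip y y≉0    ≈⟨ *-congʳ xy≈0 ⟩
    0# * recip y y≉0       ≈⟨ zeroˡ _ ⟩
    0#                     ∎

  ∑≡sum : ∀ {N} (f : Fin N → Carrier) → ∑ F f ≡ sum f
  ∑≡sum {zero}  f = ≡.refl
  ∑≡sum {suc N} f = ≡.cong (f zero +_) (∑≡sum (f ∘ suc))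

  unit : ∀ {N} → Fin N → Fin N → Carrier
  unit k x with x ≟ k
  ... | yes _ = 1#
  ... | no  _ = 0#

  unit-≡ : ∀ {N} (k : Fin N) → unit k k ≈ 1#
  unit-≡ k with k ≟ k
  ... | yes _  = refl
  ... | no k≢k = ⊥-elim (k≢k ≡.refl)

  unit-≢ : ∀ {N} {k x : Fin N} → x ≢ k → unit k x ≈ 0#
  unit-≢ {k = k} {x} x≢k with x ≟ k
  ... | yes x≡k = ⊥-elim (x≢k x≡k)
  ... | no  _   = refl

  erase : ∀ {N} → Fin N → (Fin N → Carrier) → Fin N → Carrier
  erase k γ x with x ≟ k
  ... | yes _ = 0#
  ... | no  _ = γ x

  erase-≡ : ∀ {N} (k : Fin N) γ → erase k γ k ≈ 0#
  erase-≡ k γ with k ≟ k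
  ... | yes _  = refl
  ... | no k≢k = ⊥-elim (k≢k ≡.refl)

  erase-≢ : ∀ {N} {k x : Fin N} γ → x ≢ k → erase k γ x ≈ γ x
  erase-≢ {k = k} {x} γ x≢k with x ≟ k
  ... | yes x≡k = ⊥-elim (x≢k x≡k)
  ... | no  _   = refl

  sum-0 : ∀ {N} {f : Fin N → Carrier} → (∀ x → f x ≈ 0#) → sum f ≈ 0#
  sum-0 {N} f≈0 = trans (sum-cong-≋ f≈0) (sum-replicate-zero N)

  sum-neg : ∀ {N} (f : Fin N → Carrier) → sum (λ x → - f x) ≈ - sum f
  sum-neg f = inverseʳ-unique _ _ (begin
    sum f + sum (λ x → - f x)  ≈⟨ sym (∑-distrib-+ f (λ x → - f x)) ⟩
    sum (λ x → f x + - f x)    ≈⟨ sum-0 (λ x → -‿inverseʳ (f x)) ⟩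
    0#                         ∎)

  lincomb : ∀ {N n} → (Fin N → Fin n → Carrier) → (Fin N → Carrier) → Fin n → Carrier
  lincomb φ γ j = sum (λ x → γ x * φ x j)

  SupportedOn : ∀ {N} → Pred (Fin N) 0ℓ → (Fin N → Carrier) → Set ℓ
  SupportedOn Q γ = ∀ x → x ∉ Q → γ x ≈ 0#

  IsRelation : ∀ {N n} → (Fin N → Fin n → Carrier) → (Fin N → Carrier) → Set ℓ
  IsRelation φ γ = ∀ j → lincomb φ γ j ≈ 0#

  Independent : ∀ {N n} → (Fin N → Fin n → Carrier) → Pred (Fin N) 0ℓ → Set (c ⊔ ℓ)
  Independent φ Q = ∀ γ → SupportedOn Q γ → IsRelation φ γ → ∀ x → γ x ≈ 0#

  Dependent : ∀ {N n} → (Fin N → Fin n → Carrier) → Pred (Fin N) 0ℓ → Set (c ⊔ ℓ)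
  Dependent φ Q = ∃ λ γ → SupportedOn Q γ × IsRelation φ γ × ∃ λ x → γ x ≉ 0#

  InSpan : ∀ {N n} → (Fin N → Fin n → Carrier) → Pred (Fin N) 0ℓ → (Fin n → Carrier) → Set (c ⊔ ℓ)
  InSpan φ Q v = ∃ λ γ → SupportedOn Q γ × (∀ j → lincomb φ γ j ≈ v j)

  LinIndep⇔Independent : ∀ {N n} (φ : Fin N → Fin n → Carrier) X →
    (LinIndep F φ X → Independent φ (Subset._∈ X)) × (Independent φ (Subset._∈ X) → LinIndep F φ X)
  LinIndep⇔Independent φ X =
    (λ li γ s r → li γ s (λ j → ≡.subst (_≈ 0#) (≡.sym (∑≡sum (λ x → γ x * φ x j))) (r j))) ,
    (λ li γ s r → li γ s (λ j → ≡.subst (_≈ 0#) (∑≡sum (λ x → γ x * φ x j)) (r j)))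

  lincomb-erase : ∀ {N n} (φ : Fin N → Fin n → Carrier) k γ j →
                  lincomb φ γ j ≈ γ k * φ k j + lincomb φ (erase k γ) j
  lincomb-erase {suc N} φ k γ j = begin
    lincomb φ γ j
      ≈⟨ sum-remove {i = k} (λ x → γ x * φ x j) ⟩
    γ k * φ k j + sum (λ i → γ (punchIn k i) * φ (punchIn k i) j)
      ≈⟨ +-congˡ (sum-cong-≋ (λ i → *-congʳ (sym (erase-≢ γ (Fin.punchInᵢ≢i k i))))) ⟩
    γ k * φ k j + sum (λ i → erase k γ (punchIn k i) * φ (punchIn k i) j)
      ≈⟨ +-congˡ (sym (+-identityˡ _)) ⟩
    γ k * φ k j + (0# + sum (λ i → erase k γ (punchIn k i) * φ (punchIn k i) j))
      ≈⟨ +-congˡ (+-congʳ (sym (trans (*-congʳ (erase-≡ k γ)) (zeroˡ _)))) ⟩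
    γ k * φ k j + (erase k γ k * φ k j + sum (λ i → erase k γ (punchIn k i) * φ (punchIn k i) j))
      ≈⟨ +-congˡ (sym (sum-remove {i = k} (λ x → erase k γ x * φ x j))) ⟩
    γ k * φ k j + lincomb φ (erase k γ) j ∎

  module _ {N n} (φ : Fin N → Fin n → Carrier) where

    lincomb-cong : ∀ {γ η} → (∀ x → γ x ≈ η x) → ∀ j → lincomb φ γ j ≈ lincomb φ η j
    lincomb-cong γ≈η j = sum-cong-≋ (λ x → *-congʳ (γ≈η x))

    lincomb-+ : ∀ γ η j → lincomb φ (λ x → γ x + η x) j ≈ lincomb φ γ j + lincomb φ η j
    lincomb-+ γ η j = trans (sum-cong-≋ (λ x → distribʳ (φ x j) (γ x) (η x)))
                            (∑-distrib-+ (λ x → γ x * φ x j) (λ x → η x * φ x j))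

    lincomb-* : ∀ a γ j → lincomb φ (λ x → a * γ x) j ≈ a * lincomb φ γ j
    lincomb-* a γ j = trans (sum-cong-≋ (λ x → *-assoc a (γ x) (φ x j)))
                            (sym (*-distribˡ-sum a (λ x → γ x * φ x j)))

    lincomb-0 : ∀ {γ} → (∀ x → γ x ≈ 0#) → ∀ j → lincomb φ γ j ≈ 0#
    lincomb-0 γ≈0 j = sum-0 (λ x → trans (*-congʳ (γ≈0 x)) (zeroˡ (φ x j)))

    lincomb-neg : ∀ γ j → lincomb φ (λ x → - γ x) j ≈ - lincomb φ γ j
    lincomb-neg γ j = trans (sum-cong-≋ (λ x → sym (-‿distribˡ-* (γ x) (φ x j)))) (sum-neg (λ x → γ x * φ x j))

    lincomb-unit : ∀ k j → lincomb φ (unit k) j ≈ φ k j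
    lincomb-unit k j = begin
      lincomb φ (unit k) j                               ≈⟨ lincomb-erase φ k (unit k) j ⟩
      unit k k * φ k j + lincomb φ (erase k (unit k)) j  ≈⟨ +-cong (*-congʳ (unit-≡ k)) (lincomb-0 erased j) ⟩
      1# * φ k j + 0#                                    ≈⟨ +-identityʳ _ ⟩
      1# * φ k j                                         ≈⟨ *-identityˡ _ ⟩
      φ k j                                              ∎
      where
      erased : ∀ x → erase k (unit k) x ≈ 0#
      erased x with x ≟ k
      ... | yes _ = refl
      ... | no x≢k = unit-≢ x≢k

  Independent-mono : ∀ {N n} (φ : Fin N → Fin n → Carrier) {Q R} → Q ⊆ R → Independent φ R → Independent φ Q
  Independent-mono φ Q⊆R ind γ γ∈Q = ind γ (λ x x∉R → γ∈Q x (x∉R ∘ Q⊆R))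

  module Pivot {N n} (φ : Fin N → Fin (suc n) → Carrier) (Q : Pred (Fin N) 0ℓ)
               (k : Fin N) (k∈Q : k ∈ Q) (pivot≉0 : φ k zero ≉ 0#) where

    ρ : Carrier
    ρ = recip (φ k zero) pivot≉0

    reduced : Fin N → Fin n → Carrier
    reduced x j = φ x (suc j) + - (φ x zero * ρ * φ k (suc j))

    lincomb-reduced : ∀ η j →
      lincomb reduced η j ≈ lincomb φ η (suc j) + - (lincomb φ η zero * ρ * φ k (suc j))
    lincomb-reduced η j = begin
      sum (λ x → η x * reduced x j)
        ≈⟨ sum-cong-≋ (λ x → trans (distribˡ (η x) _ _) (+-congˡ (sym (-‿distribʳ-* (η x) _)))) ⟩
      sum (λ x → η x * φ x (suc j) + - (η x * (φ x zero * ρ * φ k (suc j))))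
        ≈⟨ ∑-distrib-+ (λ x → η x * φ x (suc j)) _ ⟩
      lincomb φ η (suc j) + sum (λ x → - (η x * (φ x zero * ρ * φ k (suc j))))
        ≈⟨ +-congˡ (sum-cong-≋ (λ x → -‿cong (reassoc (η x) (φ x zero)))) ⟩
      lincomb φ η (suc j) + sum (λ x → - (η x * φ x zero * (ρ * φ k (suc j))))
        ≈⟨ +-congˡ (sum-neg (λ x → η x * φ x zero * (ρ * φ k (suc j)))) ⟩
      lincomb φ η (suc j) + - sum (λ x → η x * φ x zero * (ρ * φ k (suc j)))
        ≈⟨ +-congˡ (-‿cong (sym (*-distribʳ-sum _ (λ x → η x * φ x zero)))) ⟩
      lincomb φ η (suc j) + - (lincomb φ η zero * (ρ * φ k (suc j)))
        ≈⟨ +-congˡ (-‿cong (sym (*-assoc _ _ _))) ⟩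
      lincomb φ η (suc j) + - (lincomb φ η zero * ρ * φ k (suc j)) ∎
      where
      reassoc : ∀ a h → a * (h * ρ * φ k (suc j)) ≈ a * h * (ρ * φ k (suc j))
      reassoc = λ a h → solve 4 (λ a h ρ t → a :* (h :* ρ :* t) := a :* h :* (ρ :* t)) refl a h ρ (φ k (suc j))

    independent-lift : Independent reduced (Q ∩ ∁ ｛ k ｝) → Independent φ Q
    independent-lift ind γ γ∈Q rel = γ≈0
      where
      γ′ : Fin N → Carrier
      γ′ = erase k γ

      lincomb-γ′ : ∀ i → lincomb φ γ′ i ≈ - (γ k * φ k i)
      lincomb-γ′ i = inverseʳ-unique _ _ (trans (sym (lincomb-erase φ k γ i)) (rel i))

      γ′∈Q∖k : SupportedOn (Q ∩ ∁ ｛ k ｝) γ′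
      γ′∈Q∖k x x∉Q∖k with x ≟ k
      ... | yes _   = refl
      ... | no  x≢k = γ∈Q x (λ x∈Q → x∉Q∖k (x∈Q , x≢k ∘ ≡.sym))

      pivot-cancel : ∀ t → - (γ k * φ k zero) * ρ * t ≈ - (γ k * t)
      pivot-cancel t = begin
        - (γ k * φ k zero) * ρ * t   ≈⟨ *-congʳ (sym (-‿distribˡ-* _ _)) ⟩
        - (γ k * φ k zero * ρ) * t   ≈⟨ sym (-‿distribˡ-* _ _) ⟩
        - (γ k * φ k zero * ρ * t)   ≈⟨ -‿cong (*-congʳ (*-assoc _ _ _)) ⟩
        - (γ k * (φ k zero * ρ) * t) ≈⟨ -‿cong (*-congʳ (*-congˡ (*-recipʳ _ pivot≉0))) ⟩
        - (γ k * 1# * t)             ≈⟨ -‿cong (*-congʳ (*-identityʳ _)) ⟩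
        - (γ k * t)                  ∎

      rel′ : IsRelation reduced γ′
      rel′ j = begin
        lincomb reduced γ′ j
          ≈⟨ lincomb-reduced γ′ j ⟩
        lincomb φ γ′ (suc j) + - (lincomb φ γ′ zero * ρ * φ k (suc j))
          ≈⟨ +-cong (lincomb-γ′ (suc j)) (-‿cong (*-congʳ (*-congʳ (lincomb-γ′ zero)))) ⟩
        - (γ k * φ k (suc j)) + - (- (γ k * φ k zero) * ρ * φ k (suc j))
          ≈⟨ +-congˡ (-‿cong (pivot-cancel (φ k (suc j)))) ⟩
        - (γ k * φ k (suc j)) + - - (γ k * φ k (suc j))
          ≈⟨ -‿inverseʳ _ ⟩
        0# ∎

      γ′≈0 : ∀ x → γ′ x ≈ 0#
      γ′≈0 = ind γ′ γ′∈Q∖k rel′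

      γk*pivot≈0 : γ k * φ k zero ≈ 0#
      γk*pivot≈0 = begin
        γ k * φ k zero                              ≈⟨ sym (+-identityʳ _) ⟩
        γ k * φ k zero + 0#                         ≈⟨ +-congˡ (sym (lincomb-0 φ γ′≈0 zero)) ⟩
        γ k * φ k zero + lincomb φ γ′ zero          ≈⟨ sym (lincomb-erase φ k γ zero) ⟩
        lincomb φ γ zero                            ≈⟨ rel zero ⟩
        0#                                          ∎

      γ≈0 : ∀ x → γ x ≈ 0#
      γ≈0 x with x ≟ k
      ... | yes ≡.refl = x*y≈0⇒x≈0 (γ k) (φ k zero) pivot≉0 γk*pivot≈0
      ... | no  x≢k    = trans (sym (erase-≢ γ x≢k)) (γ′≈0 x)

    dependent-lift : Dependent reduced (Q ∩ ∁ ｛ k ｝) → Dependent φ Q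
    dependent-lift (γ′ , γ′∈Q∖k , rel′ , x₀ , γ′x₀≉0) = γ , γ∈Q , rel , x₀ , γx₀≉0
      where
      μ t : Carrier
      μ = lincomb φ γ′ zero
      t = - (μ * ρ)

      γ : Fin N → Carrier
      γ x = γ′ x + t * unit k x

      lincomb-γ : ∀ i → lincomb φ γ i ≈ lincomb φ γ′ i + t * φ k i
      lincomb-γ i = trans (lincomb-+ φ γ′ _ i) (+-congˡ (trans (lincomb-* φ t (unit k) i) (*-congˡ (lincomb-unit φ k i))))

      γ∈Q : SupportedOn Q γ
      γ∈Q x x∉Q = begin
        γ′ x + t * unit k x  ≈⟨ +-cong (γ′∈Q∖k x (x∉Q ∘ proj₁)) (*-congˡ (unit-≢ x≢k)) ⟩
        0# + t * 0#          ≈⟨ +-identityˡ _ ⟩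
        t * 0#               ≈⟨ zeroʳ t ⟩
        0#                   ∎
        where
        x≢k : x ≢ k
        x≢k ≡.refl = x∉Q k∈Q

      rel : IsRelation φ γ
      rel zero = begin
        lincomb φ γ zero          ≈⟨ lincomb-γ zero ⟩
        μ + - (μ * ρ) * φ k zero  ≈⟨ +-congˡ (sym (-‿distribˡ-* _ _)) ⟩
        μ + - (μ * ρ * φ k zero)  ≈⟨ +-congˡ (-‿cong (*-assoc _ _ _)) ⟩
        μ + - (μ * (ρ * φ k zero)) ≈⟨ +-congˡ (-‿cong (*-congˡ (*-recipˡ _ pivot≉0))) ⟩
        μ + - (μ * 1#)            ≈⟨ +-congˡ (-‿cong (*-identityʳ μ)) ⟩
        μ + - μ                   ≈⟨ -‿inverseʳ μ ⟩
        0#                        ∎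
      rel (suc j) = begin
        lincomb φ γ (suc j)                                  ≈⟨ lincomb-γ (suc j) ⟩
        lincomb φ γ′ (suc j) + - (μ * ρ) * φ k (suc j)       ≈⟨ +-congˡ (sym (-‿distribˡ-* _ _)) ⟩
        lincomb φ γ′ (suc j) + - (μ * ρ * φ k (suc j))       ≈⟨ sym (lincomb-reduced γ′ j) ⟩
        lincomb reduced γ′ j                                 ≈⟨ rel′ j ⟩
        0#                                                   ∎

      γx₀≉0 : γ x₀ ≉ 0#
      γx₀≉0 = by-cases (x₀ ≟ k)
        where
        by-cases : Dec (x₀ ≡ k) → γ x₀ ≉ 0#
        by-cases (yes ≡.refl) _     = γ′x₀≉0 (γ′∈Q∖k k (λ (_ , k≢k) → k≢k ≡.refl))
        by-cases (no x₀≢k)   γx₀≈0 = γ′x₀≉0 (begin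
          γ′ x₀                  ≈⟨ sym (+-identityʳ _) ⟩
          γ′ x₀ + 0#             ≈⟨ +-congˡ (sym (trans (*-congˡ (unit-≢ x₀≢k)) (zeroʳ t))) ⟩
          γ′ x₀ + t * unit k x₀  ≈⟨ γx₀≈0 ⟩
          0#                     ∎)

  module _ {N n} (φ : Fin N → Fin (suc n) → Carrier) {Q : Pred (Fin N) 0ℓ} (Q? : Decidable Q)
           (no-pivot : ∀ x → x ∈ Q → φ x zero ≈ 0#) where

    tail-independent : Independent (λ x j → φ x (suc j)) Q → Independent φ Q
    tail-independent ind γ γ∈Q rel = ind γ γ∈Q (rel ∘ suc)

    tail-dependent : Dependent (λ x j → φ x (suc j)) Q → Dependent φ Q
    tail-dependent (γ , γ∈Q , rel , nontrivial) = γ , γ∈Q , rel′ , nontrivial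
      where
      term≈0 : ∀ x → γ x * φ x zero ≈ 0#
      term≈0 x with Q? x
      ... | yes x∈Q = trans (*-congˡ (no-pivot x x∈Q)) (zeroʳ (γ x))
      ... | no  x∉Q = trans (*-congʳ (γ∈Q x x∉Q)) (zeroˡ (φ x zero))

      rel′ : IsRelation φ γ
      rel′ zero    = sum-0 term≈0
      rel′ (suc j) = rel j

  -- Gaussian elimination on the first coordinate; excluded middle is needed only for the
  -- finitely many tests φ x zero ≈ 0#, which is why the dichotomy holds under ¬ ¬.
  independent-or-dependent : ∀ {N} n (φ : Fin N → Fin n → Carrier) {Q : Pred (Fin N) 0ℓ} →
                             Decidable Q → ¬ ¬ (Independent φ Q ⊎ Dependent φ Q)
  independent-or-dependent zero φ {Q} Q? with Fin.any? Q?
  ... | yes (k , k∈Q) = return (inj₂ (unit k , unit-outside , (λ ()) , k , 1≉0 ∘ trans (sym (unit-≡ k))))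
    where
    unit-outside : SupportedOn Q (unit k)
    unit-outside x x∉Q = unit-≢ {k = k} {x} λ { ≡.refl → x∉Q k∈Q }
  ... | no  ∄x∈Q      = return (inj₁ (λ γ γ∈Q _ x → γ∈Q x (λ x∈Q → ∄x∈Q (x , x∈Q))))
  independent-or-dependent {N} (suc n) φ {Q} Q? = do
    vanishes? ← ¬¬-∀ N (λ x → ¬¬-excluded-middle {A = φ x zero ≈ 0#})
    eliminate vanishes? (Fin.any? (λ x → Q? x ×-dec ¬? (vanishes? x)))
    where
    eliminate : (∀ x → Dec (φ x zero ≈ 0#)) → Dec (∃ λ k → k ∈ Q × φ k zero ≉ 0#) →
                ¬ ¬ (Independent φ Q ⊎ Dependent φ Q)
    eliminate _ (yes (k , k∈Q , pivot≉0)) =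
      ¬¬-map (Sum.map independent-lift dependent-lift)
             (independent-or-dependent n reduced (Q? ∩? ∁? (k ≟_)))
      where open Pivot φ Q k k∈Q pivot≉0
    eliminate vanishes? (no ∄pivot) =
      ¬¬-map (Sum.map (tail-independent φ Q? no-pivot) (tail-dependent φ Q? no-pivot))
             (independent-or-dependent n (λ x j → φ x (suc j)) Q?)
      where
      no-pivot : ∀ x → x ∈ Q → φ x zero ≈ 0#
      no-pivot x x∈Q with vanishes? x
      ... | yes pivot≈0 = pivot≈0
      ... | no  pivot≉0 = ⊥-elim (∄pivot (x , x∈Q , pivot≉0))

  dependent-if-not-independent : ∀ {N n} (φ : Fin N → Fin n → Carrier) {Q : Pred (Fin N) 0ℓ} →
                                 Decidable Q → ¬ Independent φ Q → ¬ ¬ Dependent φ Q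
  dependent-if-not-independent {n = n} φ Q? ¬ind =
    independent-or-dependent n φ Q? >>= [ ⊥-elim ∘ ¬ind , return ]′

  module _ {N n} (φ : Fin N → Fin n → Carrier) where

    ∈⇒InSpan : ∀ {Q x} → x ∈ Q → InSpan φ Q (φ x)
    ∈⇒InSpan {x = x} x∈Q = unit x , (λ y y∉Q → unit-≢ {k = x} {y} λ { ≡.refl → y∉Q x∈Q }) , lincomb-unit φ x

    InSpan-mono : ∀ {Q R v} → Q ⊆ R → InSpan φ Q v → InSpan φ R v
    InSpan-mono Q⊆R (γ , γ∈Q , γ↦v) = γ , (λ x x∉R → γ∈Q x (x∉R ∘ Q⊆R)) , γ↦v

    InSpan-cong : ∀ {Q v w} → (∀ j → v j ≈ w j) → InSpan φ Q v → InSpan φ Q w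
    InSpan-cong v≈w (γ , γ∈Q , γ↦v) = γ , γ∈Q , (λ j → trans (γ↦v j) (v≈w j))

    InSpan-scale : ∀ {Q v} a → InSpan φ Q v → InSpan φ Q (λ j → a * v j)
    InSpan-scale a (γ , γ∈Q , γ↦v) =
      (λ x → a * γ x) ,
      (λ x x∉Q → trans (*-congˡ (γ∈Q x x∉Q)) (zeroʳ a)) ,
      (λ j → trans (lincomb-* φ a γ j) (*-congˡ (γ↦v j)))

    InSpan-combine : ∀ {Q R u v} a b → InSpan φ Q u → InSpan φ R v →
                     InSpan φ (Q ∪ R) (λ j → a * u j + b * v j)
    InSpan-combine a b (γ , γ∈Q , γ↦u) (η , η∈R , η↦v) =
      (λ x → a * γ x + b * η x) ,
      (λ x x∉Q∪R → begin
        a * γ x + b * η x  ≈⟨ +-cong (*-congˡ (γ∈Q x (x∉Q∪R ∘ inj₁))) (*-congˡ (η∈R x (x∉Q∪R ∘ inj₂))) ⟩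
        a * 0# + b * 0#    ≈⟨ +-cong (zeroʳ a) (zeroʳ b) ⟩
        0# + 0#            ≈⟨ +-identityʳ 0# ⟩
        0#                 ∎) ,
      (λ j → begin
        lincomb φ (λ x → a * γ x + b * η x) j                        ≈⟨ lincomb-+ φ _ _ j ⟩
        lincomb φ (λ x → a * γ x) j + lincomb φ (λ x → b * η x) j    ≈⟨ +-cong (lincomb-* φ a γ j) (lincomb-* φ b η j) ⟩
        a * lincomb φ γ j + b * lincomb φ η j                        ≈⟨ +-cong (*-congˡ (γ↦u j)) (*-congˡ (η↦v j)) ⟩
        _                                                            ∎)

    InSpan-trans : ∀ {Q R v} → Decidable R → (∀ y → y ∈ R → InSpan φ Q (φ y)) → InSpan φ R v → InSpan φ Q v
    InSpan-trans {Q} {R} {v} R? R⊆span (γ , γ∈R , γ↦v) = δ , δ∈Q , δ↦v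
      where
      coeffs : ∀ y → Dec (y ∈ R) → Fin N → Carrier
      coeffs y (yes y∈R) = proj₁ (R⊆span y y∈R)
      coeffs y (no _)    = λ _ → 0#

      coeffs∈Q : ∀ y (y∈R? : Dec (y ∈ R)) → SupportedOn Q (coeffs y y∈R?)
      coeffs∈Q y (yes y∈R) = proj₁ (proj₂ (R⊆span y y∈R))
      coeffs∈Q y (no _)    = λ _ _ → refl

      coeffs↦ : ∀ y (y∈R? : Dec (y ∈ R)) j → γ y * lincomb φ (coeffs y y∈R?) j ≈ γ y * φ y j
      coeffs↦ y (yes y∈R) j = *-congˡ (proj₂ (proj₂ (R⊆span y y∈R)) j)
      coeffs↦ y (no y∉R)  j = trans γy*≈0 (sym γy*≈0)
        where
        γy*≈0 : ∀ {u} → γ y * u ≈ 0#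
        γy*≈0 = trans (*-congʳ (γ∈R y y∉R)) (zeroˡ _)

      D : Fin N → Fin N → Carrier
      D y = coeffs y (R? y)

      δ : Fin N → Carrier
      δ x = sum (λ y → γ y * D y x)

      δ∈Q : SupportedOn Q δ
      δ∈Q x x∉Q = sum-0 (λ y → trans (*-congˡ (coeffs∈Q y (R? y) x x∉Q)) (zeroʳ (γ y)))

      δ↦v : ∀ j → lincomb φ δ j ≈ v j
      δ↦v j = begin
        sum (λ x → sum (λ y → γ y * D y x) * φ x j)
          ≈⟨ sum-cong-≋ (λ x → trans (*-distribʳ-sum (φ x j) (λ y → γ y * D y x))
                                     (sum-cong-≋ (λ y → *-assoc (γ y) (D y x) (φ x j)))) ⟩
        sum (λ x → sum (λ y → γ y * (D y x * φ x j)))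
          ≈⟨ ∑-comm (λ x y → γ y * (D y x * φ x j)) ⟩
        sum (λ y → sum (λ x → γ y * (D y x * φ x j)))
          ≈⟨ sum-cong-≋ (λ y → trans (sym (*-distribˡ-sum (γ y) (λ x → D y x * φ x j))) (coeffs↦ y (R? y) j)) ⟩
        lincomb φ γ j
          ≈⟨ γ↦v j ⟩
        v j ∎

    InSpan-unique : ∀ {R Q₁ Q₂ v} → Independent φ R → Q₁ ⊆ R → Q₂ ⊆ R →
                    (s₁ : InSpan φ Q₁ v) (s₂ : InSpan φ Q₂ v) → ∀ x → proj₁ s₁ x ≈ proj₁ s₂ x
    InSpan-unique {R} ind Q₁⊆R Q₂⊆R (γ , γ∈Q₁ , γ↦v) (η , η∈Q₂ , η↦v) x =
      x∙y⁻¹≈ε⇒x≈y _ _ (ind (λ y → γ y + - η y) γ-η∈R rel x)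
      where
      γ-η∈R : SupportedOn R (λ y → γ y + - η y)
      γ-η∈R y y∉R = begin
        γ y + - η y  ≈⟨ +-cong (γ∈Q₁ y (y∉R ∘ Q₁⊆R)) (-‿cong (η∈Q₂ y (y∉R ∘ Q₂⊆R))) ⟩
        0# + - 0#    ≈⟨ +-identityˡ _ ⟩
        - 0#         ≈⟨ ε⁻¹≈ε ⟩
        0#           ∎

      rel : IsRelation φ (λ y → γ y + - η y)
      rel j = begin
        lincomb φ (λ y → γ y + - η y) j            ≈⟨ lincomb-+ φ γ _ j ⟩
        lincomb φ γ j + lincomb φ (λ y → - η y) j  ≈⟨ +-congˡ (lincomb-neg φ η j) ⟩
        lincomb φ γ j + - lincomb φ η j            ≈⟨ +-cong (γ↦v j) (-‿cong (η↦v j)) ⟩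
        _ + - _                                    ≈⟨ -‿inverseʳ _ ⟩
        0#                                         ∎

    ∉-InSpan : ∀ {R Q z} → Independent φ R → z ∈ R → z ∉ Q → Q ⊆ R → ¬ InSpan φ Q (φ z)
    ∉-InSpan {R} {Q} {z} ind z∈R z∉Q Q⊆R z∈span = 1≉0 (begin
      1#                    ≈⟨ sym (unit-≡ z) ⟩
      unit z z              ≈⟨ sym (InSpan-unique ind Q⊆R ｛z｝⊆R z∈span (∈⇒InSpan ≡.refl) z) ⟩
      proj₁ z∈span z        ≈⟨ proj₁ (proj₂ z∈span) z z∉Q ⟩
      0#                    ∎)
      where
      ｛z｝⊆R : ｛ z ｝ ⊆ R
      ｛z｝⊆R ≡.refl = z∈R

    dependent⇒InSpan : ∀ {Q R z} → R ⊆ Q ∪ ｛ z ｝ → Independent φ Q → Dependent φ R → InSpan φ Q (φ z)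
    dependent⇒InSpan {Q} {R} {z} R⊆Q∪z ind (γ , γ∈R , rel , x₀ , γx₀≉0) = δ , δ∈Q , δ↦φz
      where
      γ∈Q∪z : ∀ x → x ∉ Q → z ≢ x → γ x ≈ 0#
      γ∈Q∪z x x∉Q z≢x = γ∈R x (λ x∈R → [ x∉Q , z≢x ]′ (R⊆Q∪z x∈R))

      γz≉0 : γ z ≉ 0#
      γz≉0 γz≈0 = γx₀≉0 (ind γ γ∈Q rel x₀)
        where
        γ∈Q : SupportedOn Q γ
        γ∈Q x x∉Q with z ≟ x
        ... | yes ≡.refl = γz≈0
        ... | no  z≢x    = γ∈Q∪z x x∉Q z≢x

      g : Carrier
      g = recip (γ z) γz≉0

      δ : Fin N → Carrier
      δ x = - (g * erase z γ x)

      δ∈Q : SupportedOn Q δ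
      δ∈Q x x∉Q with x ≟ z
      ... | yes _   = trans (-‿cong (zeroʳ g)) ε⁻¹≈ε
      ... | no  x≢z = trans (-‿cong (trans (*-congˡ (γ∈Q∪z x x∉Q (x≢z ∘ ≡.sym))) (zeroʳ g))) ε⁻¹≈ε

      δ↦φz : ∀ j → lincomb φ δ j ≈ φ z j
      δ↦φz j = begin
        lincomb φ (λ x → - (g * erase z γ x)) j  ≈⟨ lincomb-neg φ _ j ⟩
        - lincomb φ (λ x → g * erase z γ x) j    ≈⟨ -‿cong (lincomb-* φ g _ j) ⟩
        - (g * lincomb φ (erase z γ) j)          ≈⟨ -‿cong (*-congˡ erased) ⟩
        - (g * - (γ z * φ z j))                  ≈⟨ -‿cong (sym (-‿distribʳ-* g _)) ⟩
        - - (g * (γ z * φ z j))                  ≈⟨ ⁻¹-involutive _ ⟩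
        g * (γ z * φ z j)                        ≈⟨ sym (*-assoc g _ _) ⟩
        g * γ z * φ z j                          ≈⟨ *-congʳ (*-recipˡ (γ z) γz≉0) ⟩
        1# * φ z j                               ≈⟨ *-identityˡ _ ⟩
        φ z j                                    ∎
        where
        erased : lincomb φ (erase z γ) j ≈ - (γ z * φ z j)
        erased = inverseʳ-unique _ _ (trans (sym (lincomb-erase φ z γ j)) (rel j))

    InSpan-circuits : ∀ {Q B : Pred (Fin N) 0ℓ} {x} → Decidable Q → Decidable B →
      (∀ z → z ∈ B → z ∉ Q → x ≢ z → ¬ Independent φ (Q ∪ ｛ x ｝ ∪ ｛ z ｝)) →
      Independent φ (Q ∪ ｛ x ｝) → ¬ ¬ (∀ {v} → InSpan φ B v → InSpan φ (Q ∪ ｛ x ｝) v)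
    InSpan-circuits {Q} {B} {x} Q? B? circuit ind = do
      B⊆span ← ¬¬-∀ N (λ z → each z (B? z) (Q? z) (x ≟ z))
      return (λ {v} → InSpan-trans B? B⊆span)
      where
      each : ∀ z → Dec (z ∈ B) → Dec (z ∈ Q) → Dec (x ≡ z) → ¬ ¬ (z ∈ B → InSpan φ (Q ∪ ｛ x ｝) (φ z))
      each z (no z∉B) _ _         = return (⊥-elim ∘ z∉B)
      each z _ (yes z∈Q) _        = return (λ _ → ∈⇒InSpan (inj₁ z∈Q))
      each z _ _ (yes x≡z)        = return (λ _ → ∈⇒InSpan (inj₂ x≡z))
      each z (yes z∈B) (no z∉Q) (no x≢z) =
        ¬¬-map (λ dep _ → dependent⇒InSpan reassoc ind dep)
               (dependent-if-not-independent φ (Q? ∪? (x ≟_) ∪? (z ≟_)) (circuit z z∈B z∉Q x≢z))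
        where
        reassoc : Q ∪ ｛ x ｝ ∪ ｛ z ｝ ⊆ (Q ∪ ｛ x ｝) ∪ ｛ z ｝
        reassoc (inj₁ y∈Q)        = inj₁ (inj₁ y∈Q)
        reassoc (inj₂ (inj₁ x≡y)) = inj₁ (inj₂ x≡y)
        reassoc (inj₂ (inj₂ z≡y)) = inj₂ z≡y

  module _ {N n} (φ : Fin N → Fin n → Carrier) where

    InSpan-∩ : ∀ {Q x y v} → Independent φ (Q ∪ ｛ x ｝ ∪ ｛ y ｝) → x ∉ Q → x ≢ y →
               InSpan φ (Q ∪ ｛ x ｝) v → InSpan φ (Q ∪ ｛ y ｝) v → InSpan φ Q v
    InSpan-∩ {Q} {x} {y} ind x∉Q x≢y s₁@(γ , γ∈Q∪x , γ↦v) s₂ = γ , γ∈Q , γ↦v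
      where
      γx≈0 : γ x ≈ 0#
      γx≈0 = trans (InSpan-unique φ ind Q∪x⊆ Q∪y⊆ s₁ s₂ x)
                   (proj₁ (proj₂ s₂) x [ x∉Q , (λ y≡x → x≢y (≡.sym y≡x)) ]′)
        where
        Q∪x⊆ : Q ∪ ｛ x ｝ ⊆ Q ∪ ｛ x ｝ ∪ ｛ y ｝
        Q∪x⊆ = [ inj₁ , inj₂ ∘ inj₁ ]′
        Q∪y⊆ : Q ∪ ｛ y ｝ ⊆ Q ∪ ｛ x ｝ ∪ ｛ y ｝
        Q∪y⊆ = [ inj₁ , inj₂ ∘ inj₂ ]′

      γ∈Q : SupportedOn Q γ
      γ∈Q z z∉Q with x ≟ z
      ... | yes ≡.refl = γx≈0
      ... | no  x≢z    = γ∈Q∪x z [ z∉Q , x≢z ]′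

    InSpan-pair⇒≈0 : ∀ {Q e f a b} → Independent φ (Q ∪ ｛ e ｝ ∪ ｛ f ｝) → e ∉ Q → f ∉ Q → e ≢ f →
                     InSpan φ Q (λ j → a * φ e j + b * φ f j) → a ≈ 0# × b ≈ 0#
    InSpan-pair⇒≈0 {Q} {e} {f} {a} {b} ind e∉Q f∉Q e≢f in-span = coefficient e e∉Q a≈ , coefficient f f∉Q b≈
      where
      in-pair : InSpan φ (｛ e ｝ ∪ ｛ f ｝) (λ j → a * φ e j + b * φ f j)
      in-pair = InSpan-combine φ a b (∈⇒InSpan φ {Q = ｛ e ｝} ≡.refl) (∈⇒InSpan φ {Q = ｛ f ｝} ≡.refl)

      coefficient : ∀ x → x ∉ Q → ∀ {c} → a * unit e x + b * unit f x ≈ c → c ≈ 0#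
      coefficient x x∉Q ≈c = trans (sym ≈c) (trans (sym (InSpan-unique φ ind inj₁ inj₂ in-span in-pair x))
                                                   (proj₁ (proj₂ in-span) x x∉Q))

      a≈ : a * unit e e + b * unit f e ≈ a
      a≈ = trans (+-cong (trans (*-congˡ (unit-≡ e)) (*-identityʳ a)) (trans (*-congˡ (unit-≢ e≢f)) (zeroʳ b)))
                 (+-identityʳ a)

      b≈ : a * unit e f + b * unit f f ≈ b
      b≈ = trans (+-cong (trans (*-congˡ (unit-≢ (e≢f ∘ ≡.sym))) (zeroʳ a)) (trans (*-congˡ (unit-≡ f)) (*-identityʳ b)))
                 (+-identityˡ b)

    dependent⇒pair-InSpan : ∀ {Q e f} → e ≢ f → Independent φ Q → Dependent φ (Q ∪ ｛ e ｝ ∪ ｛ f ｝) →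
      ∃ λ a → ∃ λ b → ¬ (a ≈ 0# × b ≈ 0#) × InSpan φ Q (λ j → a * φ e j + b * φ f j)
    dependent⇒pair-InSpan {Q} {e} {f} e≢f ind (γ , γ∈Q∪ef , rel , x₀ , γx₀≉0) =
      γ e , γ f , nontrivial , (λ x → - γ′ x) , −γ′∈Q , −γ′↦
      where
      γ′ : Fin N → Carrier
      γ′ = erase f (erase e γ)

      γ′∈Q : SupportedOn Q γ′
      γ′∈Q x x∉Q with x ≟ f
      ... | yes _ = refl
      ... | no x≢f with x ≟ e
      ...   | yes _   = refl
      ...   | no  x≢e = γ∈Q∪ef x [ x∉Q , [ x≢e ∘ ≡.sym , x≢f ∘ ≡.sym ]′ ]′

      −γ′∈Q : SupportedOn Q (λ x → - γ′ x)
      −γ′∈Q x x∉Q = trans (-‿cong (γ′∈Q x x∉Q)) ε⁻¹≈ε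

      γ′↦ : ∀ j → lincomb φ γ′ j ≈ - (γ e * φ e j + γ f * φ f j)
      γ′↦ j = inverseʳ-unique _ _ (begin
        γ e * φ e j + γ f * φ f j + lincomb φ γ′ j
          ≈⟨ +-assoc _ _ _ ⟩
        γ e * φ e j + (γ f * φ f j + lincomb φ γ′ j)
          ≈⟨ +-congˡ (+-congʳ (*-congʳ (sym (erase-≢ γ (e≢f ∘ ≡.sym))))) ⟩
        γ e * φ e j + (erase e γ f * φ f j + lincomb φ γ′ j)
          ≈⟨ +-congˡ (sym (lincomb-erase φ f (erase e γ) j)) ⟩
        γ e * φ e j + lincomb φ (erase e γ) j
          ≈⟨ sym (lincomb-erase φ e γ j) ⟩
        lincomb φ γ j
          ≈⟨ rel j ⟩
        0# ∎)

      −γ′↦ : ∀ j → lincomb φ (λ x → - γ′ x) j ≈ γ e * φ e j + γ f * φ f j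
      −γ′↦ j = trans (lincomb-neg φ γ′ j) (trans (-‿cong (γ′↦ j)) (⁻¹-involutive _))

      nontrivial : ¬ (γ e ≈ 0# × γ f ≈ 0#)
      nontrivial (γe≈0 , γf≈0) = γx₀≉0 (ind γ γ∈Q rel x₀)
        where
        γ∈Q : SupportedOn Q γ
        γ∈Q x x∉Q with e ≟ x | f ≟ x
        ... | yes ≡.refl | _          = γe≈0
        ... | no _       | yes ≡.refl = γf≈0
        ... | no e≢x     | no f≢x     = γ∈Q∪ef x [ x∉Q , [ e≢x , f≢x ]′ ]′

  cramer : ∀ a b a′ b′ → a * b′ ≉ b * a′ →
           ∃ λ p → ∃ λ q → ∀ E G → p * (a * E + b * G) + q * (a′ * E + b′ * G) ≈ E
  cramer a b a′ b′ ab′≉ba′ = b′ * d⁻¹ , - (b * d⁻¹) , recover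
    where
    d : Carrier
    d = a * b′ + - (b * a′)
    d≉0 : d ≉ 0#
    d≉0 = ab′≉ba′ ∘ x∙y⁻¹≈ε⇒x≈y _ _
    d⁻¹ : Carrier
    d⁻¹ = recip d d≉0

    recover : ∀ E G → b′ * d⁻¹ * (a * E + b * G) + - (b * d⁻¹) * (a′ * E + b′ * G) ≈ E
    recover E G = begin
      b′ * d⁻¹ * X + - (b * d⁻¹) * Y
        ≈⟨ +-cong (swap b′ X) (trans (sym (-‿distribˡ-* _ _)) (trans (-‿cong (swap b Y)) (-‿distribʳ-* _ _))) ⟩
      d⁻¹ * (b′ * X) + d⁻¹ * - (b * Y)
        ≈⟨ sym (distribˡ _ _ _) ⟩
      d⁻¹ * (b′ * X + - (b * Y))
        ≈⟨ *-congˡ (+-cong (expandX) (-‿cong expandY)) ⟩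
      d⁻¹ * ((a * b′ * E + b * b′ * G) + - (b * a′ * E + b * b′ * G))
        ≈⟨ *-congˡ (cancel _ _ _) ⟩
      d⁻¹ * (a * b′ * E + - (b * a′ * E))
        ≈⟨ *-congˡ (trans (+-congˡ (-‿distribˡ-* _ _)) (sym (distribʳ _ _ _))) ⟩
      d⁻¹ * (d * E)
        ≈⟨ sym (*-assoc _ _ _) ⟩
      d⁻¹ * d * E
        ≈⟨ *-congʳ (*-recipˡ d d≉0) ⟩
      1# * E
        ≈⟨ *-identityˡ E ⟩
      E ∎
      where
      X Y : Carrier
      X = a * E + b * G
      Y = a′ * E + b′ * G
      swap : ∀ p r → p * d⁻¹ * r ≈ d⁻¹ * (p * r)
      swap p r = solve 3 (λ p i r → p :* i :* r := i :* (p :* r)) refl p d⁻¹ r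
      expandX : b′ * X ≈ a * b′ * E + b * b′ * G
      expandX = solve 5 (λ a b b′ E G → b′ :* (a :* E :+ b :* G) := a :* b′ :* E :+ b :* b′ :* G) refl a b b′ E G
      expandY : b * Y ≈ b * a′ * E + b * b′ * G
      expandY = solve 5 (λ a′ b b′ E G → b :* (a′ :* E :+ b′ :* G) := b :* a′ :* E :+ b :* b′ :* G) refl a′ b b′ E G
      cancel : ∀ p q w → (p + w) + - (q + w) ≈ p + - q
      cancel p q w = begin
        (p + w) + - (q + w)    ≈⟨ +-congˡ (sym (⁻¹-∙-comm q w)) ⟩
        (p + w) + (- q + - w)  ≈⟨ solve 4 (λ p w q′ w′ → (p :+ w) :+ (q′ :+ w′) := (p :+ q′) :+ (w :+ w′))
                                          refl p w (- q) (- w) ⟩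
        (p + - q) + (w + - w)  ≈⟨ +-congˡ (-‿inverseʳ w) ⟩
        (p + - q) + 0#         ≈⟨ +-identityʳ _ ⟩
        p + - q                ∎

  proportional : ∀ a b a′ b′ → a * b′ ≈ b * a′ → ¬ (a′ ≈ 0# × b′ ≈ 0#) →
                 ¬ ¬ (∃ λ p → ∀ E G → p * (a′ * E + b′ * G) ≈ a * E + b * G)
  proportional a b a′ b′ ab′≈ba′ a′b′≉0 = ¬¬-map by-cases (¬¬-excluded-middle {A = a′ ≈ 0#})
    where
    first≉0 : ∀ a b a′ b′ → a * b′ ≈ b * a′ → (a′≉0 : a′ ≉ 0#) →
              ∀ E G → a * recip a′ a′≉0 * (a′ * E + b′ * G) ≈ a * E + b * G
    first≉0 a b a′ b′ ab′≈ba′ a′≉0 E G = begin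
      a * i * (a′ * E + b′ * G)            ≈⟨ solve 6 (λ a i a′ b′ E G → a :* i :* (a′ :* E :+ b′ :* G)
                                                       := a :* (a′ :* i) :* E :+ a :* b′ :* i :* G) refl a i a′ b′ E G ⟩
      a * (a′ * i) * E + a * b′ * i * G    ≈⟨ +-cong (*-congʳ (trans (*-congˡ (*-recipʳ a′ a′≉0)) (*-identityʳ a)))
                                                     (*-congʳ (trans (*-congʳ ab′≈ba′) (trans (*-assoc _ _ _)
                                                       (trans (*-congˡ (*-recipʳ a′ a′≉0)) (*-identityʳ b))))) ⟩
      a * E + b * G                        ∎
      where
      i : Carrier
      i = recip a′ a′≉0

    by-cases : Dec (a′ ≈ 0#) → ∃ λ p → ∀ E G → p * (a′ * E + b′ * G) ≈ a * E + b * G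
    by-cases (no a′≉0) = _ , first≉0 a b a′ b′ ab′≈ba′ a′≉0
    by-cases (yes a′≈0) = _ , λ E G →
      trans (*-congˡ (+-comm _ _)) (trans (first≉0 b a b′ a′ (sym ab′≈ba′) b′≉0 G E) (+-comm _ _))
      where
      b′≉0 : b′ ≉ 0#
      b′≉0 b′≈0 = a′b′≉0 (a′≈0 , b′≈0)

iterate : ∀ {a} {A : Set a} → (A → A) → ℕ → A → A
iterate f zero    x = x
iterate f (suc k) x = f (iterate f k x)

module BlockCycle {c ℓ} (F : Field c ℓ) {N n m : ℕ} (φ : Fin N → Fin n → Field.Carrier F)
  (H : Fin m → Pred (Fin N) 0ℓ) (H? : ∀ i → Decidable (H i)) (H-nonempty : ∀ i → ∃ (H i))
  (H-disjoint : ∀ {i j x} → x ∈ H i → x ∈ H j → i ≡ j)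
  (e f : Fin N) (e∉H : ∀ i → e ∉ H i) (f∉H : ∀ i → f ∉ H i) (e≢f : e ≢ f)
  (next : Fin m → Fin m) (s : Fin m) (K : ℕ) where

  open Field F hiding (zero)
  open LinearAlgebra F

  walk : ℕ → Fin m
  walk k = iterate next (suc k) s

  record Dependencies : Set (c ⊔ ℓ) where
    field
      Hs∪ef-independent  : Independent φ (H s ∪ ｛ e ｝ ∪ ｛ f ｝)
      H∪ef-dependent     : ∀ i → i ≢ s → ¬ Independent φ (H i ∪ ｛ e ｝ ∪ ｛ f ｝)
      H∪next∪e-independent : ∀ i {x} → x ∈ H (next i) → Independent φ (H i ∪ ｛ x ｝ ∪ ｛ e ｝)
      H∪next-dependent   : ∀ i {x z} → x ∈ H (next i) → z ∈ H (next i) → x ≢ z →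
                           ¬ Independent φ (H i ∪ ｛ x ｝ ∪ ｛ z ｝)
      next∪H-independent : ∀ i {x} → x ∈ H i → Independent φ (H (next i) ∪ ｛ x ｝)
      next∪H-dependent   : ∀ i {x z} → x ∈ H i → z ∈ H i → x ≢ z →
                           ¬ Independent φ (H (next i) ∪ ｛ x ｝ ∪ ｛ z ｝)
      Hs∪ends-independent : ∀ {x y} → x ∈ H (walk K) → y ∈ H (walk 0) →
                           Independent φ (H s ∪ ｛ x ｝ ∪ ｛ y ｝)

  module _ (walk-avoids : ∀ k → k ≤ K → walk k ≢ s) (walk-closes : next (walk K) ≡ s)
           (walk-end≢start : walk K ≢ walk 0) (deps : Dependencies) where
    open Dependencies deps

    ef : Carrier → Carrier → Fin n → Carrier
    ef a b j = a * φ e j + b * φ f j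

    H-independent : ∀ i → Independent φ (H i)
    H-independent i = Independent-mono φ inj₁ (H∪next∪e-independent i (proj₂ (H-nonempty (next i))))

    H∪next-spans : ∀ i {x} → x ∈ H (next i) →
                   ¬ ¬ (∀ {v} → InSpan φ (H i ∪ H (next i)) v → InSpan φ (H i ∪ ｛ x ｝) v)
    H∪next-spans i x∈Hj = InSpan-circuits φ (H? i) (H? i ∪? H? (next i))
      (λ z z∈B z∉Hi x≢z → H∪next-dependent i x∈Hj ([ ⊥-elim ∘ z∉Hi , (λ z∈Hj → z∈Hj) ]′ z∈B) x≢z)
      (Independent-mono φ [ inj₁ , inj₂ ∘ inj₁ ]′ (H∪next∪e-independent i x∈Hj))

    ef-in-block : ∀ i → i ≢ s → ¬ ¬ (∃ λ a → ∃ λ b → ¬ (a ≈ 0# × b ≈ 0#) × InSpan φ (H i) (ef a b))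
    ef-in-block i i≢s = ¬¬-map (dependent⇒pair-InSpan φ e≢f (H-independent i))
      (dependent-if-not-independent φ (H? i ∪? (e ≟_) ∪? (f ≟_)) (H∪ef-dependent i i≢s))

    transfer : ∀ i {a b a′ b′} → InSpan φ (H i) (ef a b) → InSpan φ (H (next i)) (ef a′ b′) →
               ¬ (a′ ≈ 0# × b′ ≈ 0#) → ¬ ¬ InSpan φ (H (next i)) (ef a b)
    transfer i {a} {b} {a′} {b′} ab∈Hi a′b′∈Hj a′b′≉0 = do
      yes ab′≈ba′ ← ¬¬-excluded-middle {A = a * b′ ≈ b * a′}
        where no ab′≉ba′ → e-outside ab′≉ba′
      (p , p↦) ← proportional a b a′ b′ ab′≈ba′ a′b′≉0
      return (InSpan-cong φ (λ j → p↦ (φ e j) (φ f j)) (InSpan-scale φ p a′b′∈Hj))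
      where
      x : Fin N
      x = proj₁ (H-nonempty (next i))
      x∈Hj : x ∈ H (next i)
      x∈Hj = proj₂ (H-nonempty (next i))

      e-outside : a * b′ ≉ b * a′ → ¬ ¬ InSpan φ (H (next i)) (ef a b)
      e-outside ab′≉ba′ = do
        H∪next⊆ ← H∪next-spans i x∈Hj
        let (p , q , p,q↦) = cramer a b a′ b′ ab′≉ba′
            e∈span = InSpan-cong φ (λ j → p,q↦ (φ e j) (φ f j)) (InSpan-combine φ p q ab∈Hi a′b′∈Hj)
        ⊥-elim (∉-InSpan φ (H∪next∪e-independent i x∈Hj) (inj₂ (inj₂ ≡.refl))
                  [ e∉H i , (λ x≡e → e∉H (next i) (≡.subst (H (next i)) x≡e x∈Hj)) ]′
                  [ inj₁ , inj₂ ∘ inj₁ ]′ (H∪next⊆ e∈span))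

    along-walk : ∀ {a b} → ¬ (a ≈ 0# × b ≈ 0#) → InSpan φ (H (walk 0)) (ef a b) →
                 ∀ k → k ≤ K → ¬ ¬ InSpan φ (H (walk k)) (ef a b)
    along-walk ab≉0 ab∈H₀ zero    _   = return ab∈H₀
    along-walk ab≉0 ab∈H₀ (suc k) k<K = do
      ab∈Hk ← along-walk ab≉0 ab∈H₀ k (ℕ.≤-trans (ℕ.n≤1+n k) k<K)
      (a′ , b′ , a′b′≉0 , a′b′∈Hk+1) ← ef-in-block (walk (suc k)) (walk-avoids (suc k) k<K)
      transfer (walk k) ab∈Hk a′b′∈Hk+1 a′b′≉0

    next∪H-spans : ∀ i {x} → x ∈ H i →
                   ¬ ¬ (∀ {v} → InSpan φ (H i) v → InSpan φ (H (next i) ∪ ｛ x ｝) v)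
    next∪H-spans i x∈Hi = InSpan-circuits φ (H? (next i)) (H? i)
      (λ z z∈Hi _ x≢z → next∪H-dependent i x∈Hi z∈Hi x≢z) (next∪H-independent i x∈Hi)

    inconsistent : ¬ ¬ ⊥
    inconsistent = do
      (a , b , ab≉0 , ab∈H₀) ← ef-in-block (walk 0) (walk-avoids 0 z≤n)
      ab∈Hu ← along-walk ab≉0 ab∈H₀ K ℕ.≤-refl
      Hu⊆ ← next∪H-spans (walk K) x∈Hu
      H₀⊆ ← H∪next-spans s y∈H₀
      let ab∈Hs∪x = ≡.subst (λ t → InSpan φ (H t ∪ ｛ x ｝) (ef a b)) walk-closes (Hu⊆ ab∈Hu)
          ab∈Hs∪y = H₀⊆ (InSpan-mono φ inj₂ ab∈H₀)
          ab∈Hs   = InSpan-∩ φ (Hs∪ends-independent x∈Hu y∈H₀) x∉Hs x≢y ab∈Hs∪x ab∈Hs∪y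
      return (ab≉0 (InSpan-pair⇒≈0 φ Hs∪ef-independent (e∉H s) (f∉H s) e≢f ab∈Hs))
      where
      x y : Fin N
      x = proj₁ (H-nonempty (walk K))
      y = proj₁ (H-nonempty (walk 0))

      x∈Hu : x ∈ H (walk K)
      x∈Hu = proj₂ (H-nonempty (walk K))

      y∈H₀ : y ∈ H (walk 0)
      y∈H₀ = proj₂ (H-nonempty (walk 0))

      x∉Hs : x ∉ H s
      x∉Hs x∈Hs = walk-avoids K ℕ.≤-refl (H-disjoint x∈Hu x∈Hs)

      x≢y : x ≢ y
      x≢y x≡y = walk-end≢start (H-disjoint x∈Hu (≡.subst (H (walk 0)) (≡.sym x≡y) y∈H₀))

module CyclicSuccessor (n : ℕ) where
  open import Data.Nat using (_+_)
  open import Data.Fin using (toℕ; lower₁)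

  Precedes : Fin (suc n) → Fin (suc n) → Set
  Precedes = CycPred (suc (suc n))

  next : Fin (suc n) → Fin (suc n)
  next k with n ℕ.≟ toℕ k
  ... | yes _   = zero
  ... | no  n≢k = suc (lower₁ k n≢k)

  precedes-next : ∀ k → Precedes k (next k)
  precedes-next k with n ℕ.≟ toℕ k
  ... | yes n≡k = inj₂ (≡.refl , ≡.cong suc (≡.sym n≡k))
  ... | no  n≢k = inj₁ (≡.cong suc (Fin.toℕ-lower₁ k n≢k))

  precedes⇒next : ∀ {k j} → Precedes k j → j ≡ next k
  precedes⇒next {k} {j} k<j with precedes-next k
  ... | k<next = Fin.toℕ-injective (toℕ-unique k<j k<next)
    where
    toℕ-unique : ∀ {j j′} → Precedes k j → Precedes k j′ → toℕ j ≡ toℕ j′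
    toℕ-unique (inj₁ p)       (inj₁ q)       = ≡.trans p (≡.sym q)
    toℕ-unique (inj₂ (p , _)) (inj₂ (q , _)) = ≡.trans p (≡.sym q)
    toℕ-unique {j} (inj₁ p) (inj₂ (_ , q)) =
      ⊥-elim (ℕ.<-irrefl ≡.refl (≡.subst (_< suc n) (≡.trans p q) (Fin.toℕ<n j)))
    toℕ-unique {j′ = j′} (inj₂ (_ , p)) (inj₁ q) =
      ⊥-elim (ℕ.<-irrefl ≡.refl (≡.subst (_< suc n) (≡.trans q p) (Fin.toℕ<n j′)))

  next-injective : ∀ {a b} → next a ≡ next b → a ≡ b
  next-injective {a} {b} eq with precedes-next a | precedes-next b
  ... | inj₁ p       | inj₁ q       = Fin.toℕ-injective (ℕ.suc-injective (≡.trans (≡.sym p) (≡.trans (≡.cong toℕ eq) q)))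
  ... | inj₂ (_ , p) | inj₂ (_ , q) = Fin.toℕ-injective (ℕ.suc-injective (≡.trans p (≡.sym q)))
  ... | inj₁ p       | inj₂ (q , _) = ⊥-elim (ℕ.1+n≢0 (≡.trans (≡.sym p) (≡.trans (≡.cong toℕ eq) q)))
  ... | inj₂ (p , _) | inj₁ q       = ⊥-elim (ℕ.1+n≢0 (≡.trans (≡.sym q) (≡.trans (≡.cong toℕ (≡.sym eq)) p)))

  module _ (s : Fin (suc n)) where

    Position : ℕ → Set
    Position j = toℕ (iterate next j s) ≡ toℕ s + j ⊎ toℕ (iterate next j s) + suc n ≡ toℕ s + j

    position : ∀ j → j ≤ suc n → Position j
    position zero    _   = inj₁ (≡.sym (ℕ.+-identityʳ (toℕ s)))
    position (suc j) j<n with position j (ℕ.≤-trans (ℕ.n≤1+n j) j<n) | precedes-next (iterate next j s)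
    ... | inj₁ p | inj₁ q = inj₁ (≡.trans q (≡.trans (≡.cong suc p) (≡.sym (ℕ.+-suc (toℕ s) j))))
    ... | inj₁ p | inj₂ (q , q′) =
      inj₂ (≡.trans (≡.cong (_+ suc n) q) (≡.trans (≡.sym q′) (≡.trans (≡.cong suc p) (≡.sym (ℕ.+-suc (toℕ s) j)))))
    ... | inj₂ p | inj₁ q =
      inj₂ (≡.trans (≡.cong (_+ suc n) q) (≡.trans (≡.cong suc p) (≡.sym (ℕ.+-suc (toℕ s) j))))
    ... | inj₂ p | inj₂ (_ , q′) = ⊥-elim (ℕ.<-irrefl (≡.sym p) (begin-strict
        toℕ s + j  ≤⟨ ℕ.+-mono-≤ s≤v j≤v ⟩
        v + v      <⟨ ℕ.+-monoʳ-< v (ℕ.n<1+n v) ⟩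
        v + suc v  ≡⟨ ≡.cong (v +_) q′ ⟩
        v + suc n  ∎))
      where
      open ℕ.≤-Reasoning
      v : ℕ
      v = toℕ (iterate next j s)
      s≤v : toℕ s ≤ v
      s≤v = ℕ.≤-pred (≡.subst (toℕ s <_) (≡.sym q′) (Fin.toℕ<n s))
      j≤v : j ≤ v
      j≤v = ℕ.≤-pred (≡.subst (j <_) (≡.sym q′) j<n)

    iterate-≢ : ∀ j → 1 ≤ j → j ≤ n → iterate next j s ≢ s
    iterate-≢ j 1≤j j≤n eq with position j (ℕ.≤-trans j≤n (ℕ.n≤1+n n))
    ... | inj₁ p = ℕ.<⇒≢ 1≤j (≡.sym (ℕ.+-cancelˡ-≡ (toℕ s) j 0
                     (≡.trans (≡.sym p) (≡.trans (≡.cong toℕ eq) (≡.sym (ℕ.+-identityʳ (toℕ s)))))))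
    ... | inj₂ p = ℕ.<-irrefl (≡.sym (ℕ.+-cancelˡ-≡ (toℕ s) (suc n) j
                     (≡.trans (≡.cong (_+ suc n) (≡.sym (≡.cong toℕ eq))) p))) (s≤s j≤n)

    iterate-period : iterate next (suc n) s ≡ s
    iterate-period with position (suc n) ℕ.≤-refl
    ... | inj₁ p = ⊥-elim (ℕ.m+n≮n (toℕ s) (suc n) (≡.subst (_< suc n) p (Fin.toℕ<n (iterate next (suc n) s))))
    ... | inj₂ p = Fin.toℕ-injective (ℕ.+-cancelʳ-≡ _ _ _ p)

∈-tabulate⁺ : ∀ {N} (g : Fin N → Bool) {x} → g x ≡ true → x ∈ₛ tabulate g
∈-tabulate⁺ g {x} gx≡true = Vec.lookup⇒[]= x _ (≡.trans (Vec.lookup∘tabulate g x) gx≡true)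

∈-tabulate⁻ : ∀ {N} (g : Fin N → Bool) {x} → x ∈ₛ tabulate g → g x ≡ true
∈-tabulate⁻ g {x} x∈ = ≡.trans (≡.sym (Vec.lookup∘tabulate g x)) (Vec.[]=⇒lookup x∈)

toSubset : ∀ {N} {Q : Pred (Fin N) 0ℓ} → Decidable Q → Subset N
toSubset Q? = tabulate (does ∘ Q?)

∈-toSubset⁺ : ∀ {N} {Q : Pred (Fin N) 0ℓ} (Q? : Decidable Q) {x} → x ∈ Q → x ∈ₛ toSubset Q?
∈-toSubset⁺ Q? {x} x∈Q = ∈-tabulate⁺ (does ∘ Q?) (dec-true (Q? x) x∈Q)

∈-toSubset⁻ : ∀ {N} {Q : Pred (Fin N) 0ℓ} (Q? : Decidable Q) {x} → x ∈ₛ toSubset Q? → x ∈ Q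
∈-toSubset⁻ Q? {x} x∈ with Q? x | ∈-tabulate⁻ (does ∘ Q?) x∈
... | yes x∈Q | _ = x∈Q

pigeonhole-avoiding-two : ∀ {a c} (g : Fin a → Fin (suc (suc c))) {p₁ p₂} → p₁ ≢ p₂ →
  (∀ i → g i ≢ p₁) → (∀ i → g i ≢ p₂) → (∀ {i j} → g i ≡ g j → i ≡ j) → c < a → ⊥
pigeonhole-avoiding-two {a} {c} g {p₁} {p₂} p₁≢p₂ g≢p₁ g≢p₂ g-injective c<a = collision (Fin.pigeonhole c<a g″)
  where
  g′ : Fin a → Fin (suc c)
  g′ i = punchOut (g≢p₁ i ∘ ≡.sym)
  p₂′ : Fin (suc c)
  p₂′ = punchOut p₁≢p₂
  g′≢p₂′ : ∀ i → p₂′ ≢ g′ i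
  g′≢p₂′ i eq = g≢p₂ i (≡.sym (Fin.punchOut-injective p₁≢p₂ (g≢p₁ i ∘ ≡.sym) eq))
  g″ : Fin a → Fin c
  g″ i = punchOut (g′≢p₂′ i)
  collision : (∃ λ i → ∃ λ j → i <ᶠ j × g″ i ≡ g″ j) → ⊥
  collision (i , j , i<j , eq) =
    Fin.<⇒≢ i<j (g-injective (Fin.punchOut-injective (g≢p₁ i ∘ ≡.sym) (g≢p₁ j ∘ ≡.sym)
                               (Fin.punchOut-injective (g′≢p₂′ i) (g′≢p₂′ j) eq)))

encode : ∀ {k} → Fin k ⊎ Fin 2 → Fin (suc (suc k))
encode {k} = join 2 k ∘ Sum.swap

encode-injective : ∀ {k} (v w : Fin k ⊎ Fin 2) → encode v ≡ encode w → v ≡ w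
encode-injective {k} v w eq = begin
  v                                    ≡⟨ ≡.sym (Sum.swap-involutive v) ⟩
  Sum.swap (Sum.swap v)                ≡⟨ ≡.cong Sum.swap (≡.sym (Fin.splitAt-join 2 k (Sum.swap v))) ⟩
  Sum.swap (splitAt 2 (encode v))      ≡⟨ ≡.cong (Sum.swap ∘ splitAt 2) eq ⟩
  Sum.swap (splitAt 2 (encode w))      ≡⟨ ≡.cong Sum.swap (Fin.splitAt-join 2 k (Sum.swap w)) ⟩
  Sum.swap (Sum.swap w)                ≡⟨ Sum.swap-involutive w ⟩
  w                                    ∎
  where open ≡.≡-Reasoning

module Counting where
  open import Data.Nat using (_+_; _*_)
  open import Algebra.Properties.CommutativeMonoid.Sum ℕ.+-0-commutativeMonoid
    using (sum; sum-remove; sum-replicate-zero; sum-cong-≗)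

  count : ∀ {N} → (Fin N → Bool) → ℕ
  count g = ∣ tabulate g ∣

  indicator : Bool → ℕ
  indicator true  = 1
  indicator false = 0

  count-suc : ∀ {N} (g : Fin (suc N) → Bool) → count g ≡ indicator (g zero) + count (g ∘ suc)
  count-suc g with g zero
  ... | true  = ≡.refl
  ... | false = ≡.refl

  count-cong : ∀ {N} {g h : Fin N → Bool} → (∀ x → g x ≡ h x) → count g ≡ count h
  count-cong g≗h = ≡.cong ∣_∣ (Vec.tabulate-cong g≗h)

  count-const : ∀ {N} (g : Fin N → Bool) b → (∀ x → g x ≡ b) → count g ≡ N * indicator b
  count-const {zero}  g b g≡b = ≡.refl
  count-const {suc N} g b g≡b =
    ≡.trans (count-suc g) (≡.cong₂ _+_ (≡.cong indicator (g≡b zero)) (count-const (g ∘ suc) b (g≡b ∘ suc)))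

  count-↑ : ∀ a c (g : Fin (a + c) → Bool) → count g ≡ count (λ i → g (i ↑ˡ c)) + count (λ i → g (a ↑ʳ i))
  count-↑ zero    c g = ≡.refl
  count-↑ (suc a) c g = begin
    count g
      ≡⟨ count-suc g ⟩
    indicator (g zero) + count (g ∘ suc)
      ≡⟨ ≡.cong (indicator (g zero) +_) (count-↑ a c (g ∘ suc)) ⟩
    indicator (g zero) + (count (λ i → g (suc (i ↑ˡ c))) + count (λ i → g (suc a ↑ʳ i)))
      ≡⟨ ≡.sym (ℕ.+-assoc (indicator (g zero)) _ _) ⟩
    indicator (g zero) + count (λ i → g (suc (i ↑ˡ c))) + count (λ i → g (suc a ↑ʳ i))
      ≡⟨ ≡.cong (_+ count (λ i → g (suc a ↑ʳ i))) (≡.sym (count-suc (λ i → g (i ↑ˡ c)))) ⟩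
    count (λ i → g (i ↑ˡ c)) + count (λ i → g (suc a ↑ʳ i)) ∎
    where open ≡.≡-Reasoning

  count-combine : ∀ a c (g : Fin (a * c) → Bool) → count g ≡ sum (λ (q : Fin a) → count (λ (t : Fin c) → g (combine q t)))
  count-combine zero    c g = ≡.refl
  count-combine (suc a) c g =
    ≡.trans (count-↑ c (a * c) g) (≡.cong (count (λ t → g (t ↑ˡ (a * c))) +_) (count-combine a c (λ i → g (c ↑ʳ i))))

  count-block : ∀ a c (k : Fin a) (g : Fin (a * c) → Bool) →
                (∀ (q : Fin a) (t : Fin c) → g (combine q t) ≡ does (q ≟ k)) → count g ≡ c
  count-block (suc a) c k g g≡ = begin
    count g                                              ≡⟨ count-combine (suc a) c g ⟩
    sum blockCount                                       ≡⟨ sum-remove {i = k} blockCount ⟩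
    blockCount k + sum (λ i → blockCount (punchIn k i))  ≡⟨ ≡.cong₂ _+_ block-k others ⟩
    c + 0                                                ≡⟨ ℕ.+-identityʳ c ⟩
    c                                                    ∎
    where
    open ≡.≡-Reasoning
    blockCount : Fin (suc a) → ℕ
    blockCount q = count (λ (t : Fin c) → g (combine q t))
    block-k : blockCount k ≡ c
    block-k = ≡.trans (count-const _ true (λ t → ≡.trans (g≡ k t) (dec-true (k ≟ k) ≡.refl))) (ℕ.*-identityʳ c)
    others : sum (λ i → blockCount (punchIn k i)) ≡ 0
    others = ≡.trans (sum-cong-≗ (λ i → ≡.trans (count-const _ false (λ t → ≡.trans (g≡ (punchIn k i) t)
                        (dec-false (punchIn k i ≟ k) (Fin.punchInᵢ≢i k i)))) (ℕ.*-zeroʳ c)))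
                     (sum-replicate-zero a)

  count-insert : ∀ {N} (g : Fin N → Bool) x → g x ≡ false → count (λ y → g y ∨ does (x ≟ y)) ≡ suc (count g)
  count-insert g zero g0≡false = begin
    count (λ y → g y ∨ does (zero ≟ y))                ≡⟨ count-suc (λ y → g y ∨ does (zero ≟ y)) ⟩
    indicator (g zero ∨ true) + count (λ y → g (suc y) ∨ false)
      ≡⟨ ≡.cong₂ _+_ (≡.cong (λ b → indicator (b ∨ true)) g0≡false) (count-cong (Bool.∨-identityʳ ∘ g ∘ suc)) ⟩
    suc (count (g ∘ suc))
      ≡⟨ ≡.cong (λ b → suc (indicator b + count (g ∘ suc))) (≡.sym g0≡false) ⟩
    suc (indicator (g zero) + count (g ∘ suc))         ≡⟨ ≡.cong suc (≡.sym (count-suc g)) ⟩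
    suc (count g)                                      ∎
    where open ≡.≡-Reasoning
  count-insert g (suc x) gx≡false = begin
    count (λ y → g y ∨ does (suc x ≟ y))               ≡⟨ count-suc (λ y → g y ∨ does (suc x ≟ y)) ⟩
    indicator (g zero ∨ false) + count (λ y → g (suc y) ∨ does (x ≟ y))
      ≡⟨ ≡.cong₂ _+_ (≡.cong indicator (Bool.∨-identityʳ (g zero))) (count-insert (g ∘ suc) x gx≡false) ⟩
    indicator (g zero) + suc (count (g ∘ suc))         ≡⟨ ℕ.+-suc _ _ ⟩
    suc (indicator (g zero) + count (g ∘ suc))         ≡⟨ ≡.cong suc (≡.sym (count-suc g)) ⟩
    suc (count g)                                      ∎
    where open ≡.≡-Reasoning

module Kinser (m₀ : ℕ) where
  open import Data.Nat using (_+_; _*_)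
  open Counting

  r m b : ℕ
  r = 4 + m₀
  m = 3 + m₀
  b = 2 + m₀

  open CyclicSuccessor (2 + m₀) public

  elem : Fin m → Fin b → Fin (kinN r)
  elem q t = combine q t ↑ˡ 2

  special : Fin 2 → Fin (kinN r)
  special u = (m * b) ↑ʳ u

  e f : Fin (kinN r)
  e = special zero
  f = special (suc zero)

  block-elem : ∀ q t → block r (elem q t) ≡ inj₁ (q , t)
  block-elem q t rewrite Fin.splitAt-↑ˡ (m * b) (combine q t) 2 | Fin.remQuot-combine {m} {b} q t = ≡.refl

  block-special : ∀ u → block r (special u) ≡ inj₂ u
  block-special u rewrite Fin.splitAt-↑ʳ (m * b) 2 u = ≡.refl

  data Element : Fin (kinN r) → Set where
    elemᵉ    : ∀ q t → Element (elem q t)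
    specialᵉ : ∀ u → Element (special u)

  join-splitAt≡ : ∀ {x v} → splitAt (m * b) x ≡ v → join (m * b) 2 v ≡ x
  join-splitAt≡ {x} ≡.refl = Fin.join-splitAt (m * b) 2 x

  element : ∀ x → Element x
  element x with splitAt (m * b) x in eq
  ... | inj₁ y = ≡.subst Element (≡.trans (≡.cong (_↑ˡ 2) (Fin.combine-remQuot {m} b y)) (join-splitAt≡ eq))
                   (elemᵉ (proj₁ (remQuot {m} b y)) (proj₂ (remQuot {m} b y)))
  ... | inj₂ u = ≡.subst Element (join-splitAt≡ eq) (specialᵉ u)

  elem-injective : ∀ {q q′ t t′} → elem q t ≡ elem q′ t′ → q ≡ q′ × t ≡ t′
  elem-injective {q} {q′} {t} {t′} eq
    with ≡.trans (≡.sym (block-elem q t)) (≡.trans (≡.cong (block r) eq) (block-elem q′ t′))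
  ... | ≡.refl = ≡.refl , ≡.refl

  elem≢special : ∀ {q t u} → elem q t ≢ special u
  elem≢special {q} {t} {u} eq
    with ≡.trans (≡.sym (block-elem q t)) (≡.trans (≡.cong (block r) eq) (block-special u))
  ... | ()

  e≢f : e ≢ f
  e≢f eq with ≡.trans (≡.sym (block-special zero)) (≡.trans (≡.cong (block r) eq) (block-special (suc zero)))
  ... | ()

  data H (q : Fin m) : Pred (Fin (kinN r)) 0ℓ where
    elem∈H : ∀ t → elem q t ∈ H q

  H⇒elem : ∀ {q x} → x ∈ H q → ∃ λ t → elem q t ≡ x
  H⇒elem (elem∈H t) = t , ≡.refl

  H-disjoint : ∀ {i j x} → x ∈ H i → x ∈ H j → i ≡ j
  H-disjoint (elem∈H t) x∈Hj = ≡.sym (proj₁ (elem-injective (proj₂ (H⇒elem x∈Hj))))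

  ∈H-elem : ∀ {q q′ t} → elem q t ∈ H q′ → q ≡ q′
  ∈H-elem {t = t} = H-disjoint (elem∈H t)

  special∉H : ∀ {u} q → special u ∉ H q
  special∉H {u} q x∈H = elem≢special {q} {proj₁ (H⇒elem x∈H)} {u} (proj₂ (H⇒elem x∈H))

  H? : ∀ q → Decidable (H q)
  H? q x with element x
  ... | specialᵉ u = no (special∉H q)
  ... | elemᵉ q′ t with q′ ≟ q
  ...   | yes ≡.refl = yes (elem∈H t)
  ...   | no  q′≢q   = no (q′≢q ∘ ∈H-elem)

  H-nonempty : ∀ q → ∃ (H q)
  H-nonempty q = elem q zero , elem∈H zero

  𝒜 𝒜′ : KinIdx r
  𝒜  = inj₂ zero
  𝒜′ = inj₂ (suc zero)

  family-elem⁻ : ∀ {j q t} → KinFamily r (inj₁ j) (elem q t) → q ≢ j × ¬ Precedes q j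
  family-elem⁻ {j} {q} {t} a rewrite block-elem q t = a

  family-elem⁺ : ∀ {j q t} → q ≢ j × ¬ Precedes q j → KinFamily r (inj₁ j) (elem q t)
  family-elem⁺ {j} {q} {t} a rewrite block-elem q t = a

  family-elem-𝒜′ : ∀ {q t} → ¬ KinFamily r 𝒜′ (elem q t)
  family-elem-𝒜′ {q} {t} a rewrite block-elem q t = a

  family-special : ∀ {j u} → ¬ KinFamily r (inj₁ j) (special u)
  family-special {j} {u} a rewrite block-special u = a

  family-special-𝒜′ : ∀ {u} → KinFamily r 𝒜′ (special u)
  family-special-𝒜′ {u} rewrite block-special u = tt

  next-≢ : ∀ q → next q ≢ q
  next-≢ q = iterate-≢ q 1 (s≤s z≤n) (s≤s z≤n)

  next²-≢ : ∀ q → next (next q) ≢ q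
  next²-≢ q = iterate-≢ q 2 (s≤s z≤n) (s≤s (s≤s z≤n))

  Avoided : Fin m → KinIdx r → Set
  Avoided q v = v ≡ 𝒜′ ⊎ v ≡ inj₁ q ⊎ v ≡ inj₁ (next q)

  Avoids : KinIdx r → Fin (kinN r) → Set
  Avoids P y = ∀ v → KinFamily r v y → v ≢ P

  H-avoids : ∀ {q x P} → x ∈ H q → Avoided q P → Avoids P x
  H-avoids {q} (elem∈H t) (inj₁ ≡.refl)          _ a ≡.refl = family-elem-𝒜′ {q} {t} a
  H-avoids     (elem∈H t) (inj₂ (inj₁ ≡.refl))   _ a ≡.refl = proj₁ (family-elem⁻ a) ≡.refl
  H-avoids {q} (elem∈H t) (inj₂ (inj₂ ≡.refl))   _ a ≡.refl = proj₂ (family-elem⁻ a) (precedes-next q)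

  special-avoids : ∀ {j u} → Avoids (inj₁ j) (special u)
  special-avoids _ a ≡.refl = family-special a

  H-admits : ∀ {q j x} → x ∈ H q → j ≢ q → j ≢ next q → KinFamily r (inj₁ j) x
  H-admits (elem∈H t) j≢q j≢next = family-elem⁺ ((j≢q ∘ ≡.sym) , (j≢next ∘ precedes⇒next))

  others : Fin m → Fin (1 + m₀) → Fin m
  others q t = punchIn q (punchIn (punchOut (next-≢ q ∘ ≡.sym)) t)

  others-≢ : ∀ q t → others q t ≢ q
  others-≢ q t = Fin.punchInᵢ≢i q _

  others-≢next : ∀ q t → others q t ≢ next q
  others-≢next q t eq = Fin.punchInᵢ≢i _ t
    (Fin.punchIn-injective q _ _ (≡.trans eq (≡.sym (Fin.punchIn-punchOut (next-≢ q ∘ ≡.sym)))))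

  others-injective : ∀ q {t t′} → others q t ≡ others q t′ → t ≡ t′
  others-injective q eq = Fin.punchIn-injective _ _ _ (Fin.punchIn-injective q _ _ eq)

  -- the standard matching of H q: one element to 𝒜, the others to the m - 2 sets 𝒜ⱼ containing H q
  default : Fin m → Fin b → KinIdx r
  default q zero    = 𝒜
  default q (suc t) = inj₁ (others q t)

  default-injective : ∀ q {t t′} → default q t ≡ default q t′ → t ≡ t′
  default-injective q {zero}  {zero}   _  = ≡.refl
  default-injective q {suc t} {suc t′} eq = ≡.cong suc (others-injective q (Sum.inj₁-injective eq))

  default-admits : ∀ q t → KinFamily r (default q t) (elem q t)
  default-admits q zero    = tt
  default-admits q (suc t) = H-admits (elem∈H (suc t)) (others-≢ q t) (others-≢next q t)

  default-unavoided : ∀ q t → ¬ Avoided q (default q t)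
  default-unavoided q zero    (inj₁ ())
  default-unavoided q zero    (inj₂ (inj₁ ()))
  default-unavoided q zero    (inj₂ (inj₂ ()))
  default-unavoided q (suc t) (inj₁ ())
  default-unavoided q (suc t) (inj₂ (inj₁ eq)) = others-≢ q t (Sum.inj₁-injective eq)
  default-unavoided q (suc t) (inj₂ (inj₂ eq)) = others-≢next q t (Sum.inj₁-injective eq)

  defaultAt : Fin (kinN r) → KinIdx r
  defaultAt y with block r y
  ... | inj₁ (q , t) = default q t
  ... | inj₂ _       = 𝒜′

  defaultAt-elem : ∀ q t → defaultAt (elem q t) ≡ default q t
  defaultAt-elem q t rewrite block-elem q t = ≡.refl

  count-H : ∀ k → count (does ∘ H? k) ≡ b
  count-H k = begin
    count (does ∘ H? k)
      ≡⟨ count-↑ (m * b) 2 (does ∘ H? k) ⟩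
    count (λ (i : Fin (m * b)) → does (H? k (i ↑ˡ 2))) + count (λ u → does (H? k (special u)))
      ≡⟨ ≡.cong₂ _+_ (count-block m b k (λ (i : Fin (m * b)) → does (H? k (i ↑ˡ 2))) in-block)
                     (count-const (λ u → does (H? k (special u))) false (λ u → dec-false (H? k (special u)) (special∉H k))) ⟩
    b + 2 * 0
      ≡⟨ ℕ.+-identityʳ b ⟩
    b ∎
    where
    open ≡.≡-Reasoning
    in-block : ∀ q t → does (H? k (elem q t)) ≡ does (q ≟ k)
    in-block q t with q ≟ k
    ... | yes ≡.refl = dec-true (H? k (elem q t)) (elem∈H t)
    ... | no  q≢k    = dec-false (H? k (elem q t)) (q≢k ∘ ∈H-elem)

  IsBasis : Subset (kinN r) → Set
  IsBasis B = M-Indep r B × ∣ B ∣ ≡ r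

  relax-independent : ∀ {s} {Q : Pred (Fin (kinN r)) 0ℓ} (Q? : Decidable Q) {B} →
                      IsBasis B → toSubset Q? ⊆ₛ B → KinRelax-Indep r s (toSubset Q?)
  relax-independent Q? (independent , ∣B∣≡r) Q⊆B = _ , inj₁ ((independent , ℕ.≤-reflexive ∣B∣≡r) , ∣B∣≡r) , Q⊆B

  inHsHr-elem : ∀ s q t → inHsHr r s (elem q t) ≡ does (q ≟ s)
  inHsHr-elem s q t rewrite block-elem q t = ≡.refl

  H⊆HsHr : ∀ {s x} → x ∈ H s → x ∈ₛ HsHr r s
  H⊆HsHr {s} (elem∈H t) = ∈-tabulate⁺ (inHsHr r s) (≡.trans (inHsHr-elem s s t) (dec-true (s ≟ s) ≡.refl))

  special∈HsHr : ∀ {s} u → special u ∈ₛ HsHr r s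
  special∈HsHr {s} u = ∈-tabulate⁺ (inHsHr r s) in-HsHr
    where
    in-HsHr : inHsHr r s (special u) ≡ true
    in-HsHr rewrite block-special u = ≡.refl

  ∈HsHr⇒≡ : ∀ {s q x} → x ∈ H q → x ∈ₛ HsHr r s → q ≡ s
  ∈HsHr⇒≡ {s} {q} (elem∈H t) x∈ =
    decided (q ≟ s) (≡.trans (≡.sym (inHsHr-elem s q t)) (∈-tabulate⁻ (inHsHr r s) x∈))
    where
    decided : (q≟s : Dec (q ≡ s)) → does q≟s ≡ true → q ≡ s
    decided (yes q≡s) _ = q≡s

  module BlockPlusTwo (k : Fin m) {x z : Fin (kinN r)} (x∉H : x ∉ H k) (z∉H : z ∉ H k) (x≢z : x ≢ z) where

    B : Pred (Fin (kinN r)) 0ℓ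
    B = H k ∪ ｛ x ｝ ∪ ｛ z ｝

    B? : Decidable B
    B? = H? k ∪? (x ≟_) ∪? (z ≟_)

    ∣B∣ : ∣ toSubset B? ∣ ≡ r
    ∣B∣ = begin
      count (λ y → does (H? k y) ∨ (does (x ≟ y) ∨ does (z ≟ y)))
        ≡⟨ count-cong (λ y → ≡.sym (Bool.∨-assoc (does (H? k y)) (does (x ≟ y)) (does (z ≟ y)))) ⟩
      count (λ y → (does (H? k y) ∨ does (x ≟ y)) ∨ does (z ≟ y))
        ≡⟨ count-insert (λ y → does (H? k y) ∨ does (x ≟ y)) z
             (≡.cong₂ _∨_ (dec-false (H? k z) z∉H) (dec-false (x ≟ z) x≢z)) ⟩
      suc (count (λ y → does (H? k y) ∨ does (x ≟ y)))
        ≡⟨ ≡.cong suc (count-insert (does ∘ H? k) x (dec-false (H? k x) x∉H)) ⟩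
      suc (suc (count (does ∘ H? k)))
        ≡⟨ ≡.cong (λ c → suc (suc c)) (count-H k) ⟩
      r ∎
      where open ≡.≡-Reasoning

    data Member : Fin (kinN r) → Set where
      inH : ∀ t → Member (elem k t)
      isX : Member x
      isZ : Member z

    member : ∀ {y} → y ∈ B → Member y
    member (inj₁ (elem∈H t))  = inH t
    member (inj₂ (inj₁ ≡.refl)) = isX
    member (inj₂ (inj₂ ≡.refl)) = isZ

    elem≢x : ∀ t → elem k t ≢ x
    elem≢x t ≡.refl = x∉H (elem∈H t)

    elem≢z : ∀ t → elem k t ≢ z
    elem≢z t ≡.refl = z∉H (elem∈H t)

    module Matching {vx vz : KinIdx r} (vx≢vz : vx ≢ vz) (vx-avoided : Avoided k vx) (vz-avoided : Avoided k vz)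
                    (x-admits : KinFamily r vx x) (z-admits : KinFamily r vz z) where

      label : ∀ {y} → Member y → KinIdx r
      label (inH t) = default k t
      label isX     = vx
      label isZ     = vz

      label-admits : ∀ {y} (c : Member y) → KinFamily r (label c) y
      label-admits (inH t) = default-admits k t
      label-admits isX     = x-admits
      label-admits isZ     = z-admits

      label-injective : ∀ {y y′} (c : Member y) (c′ : Member y′) → label c ≡ label c′ → y ≡ y′
      label-injective (inH t) (inH t′) eq = ≡.cong (elem k) (default-injective k eq)
      label-injective isX     isX      _  = ≡.refl
      label-injective isZ     isZ      _  = ≡.refl
      label-injective isX     isZ      eq = ⊥-elim (vx≢vz eq)
      label-injective isZ     isX      eq = ⊥-elim (vx≢vz (≡.sym eq))
      label-injective (inH t) isX      eq = ⊥-elim (default-unavoided k t (≡.subst (Avoided k) (≡.sym eq) vx-avoided))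
      label-injective (inH t) isZ      eq = ⊥-elim (default-unavoided k t (≡.subst (Avoided k) (≡.sym eq) vz-avoided))
      label-injective isX     (inH t)  eq = ⊥-elim (default-unavoided k t (≡.subst (Avoided k) eq vx-avoided))
      label-injective isZ     (inH t)  eq = ⊥-elim (default-unavoided k t (≡.subst (Avoided k) eq vz-avoided))

      select : ∀ y → Dec (x ≡ y) → Dec (z ≡ y) → KinIdx r
      select y (yes _) _       = vx
      select y (no _)  (yes _) = vz
      select y (no _)  (no _)  = defaultAt y

      match : Fin (kinN r) → KinIdx r
      match y = select y (x ≟ y) (z ≟ y)

      match≡label : ∀ {y} (c : Member y) → match y ≡ label c
      match≡label {y} c = by-cases (x ≟ y) (z ≟ y) c
        where
        by-cases : (x≟y : Dec (x ≡ y)) (z≟y : Dec (z ≡ y)) (c : Member y) → select y x≟y z≟y ≡ label c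
        by-cases (yes ≡.refl) _            isX     = ≡.refl
        by-cases (yes ≡.refl) _            isZ     = ⊥-elim (x≢z ≡.refl)
        by-cases (yes x≡y)    _            (inH t) = ⊥-elim (elem≢x t (≡.sym x≡y))
        by-cases (no x≢y)     _            isX     = ⊥-elim (x≢y ≡.refl)
        by-cases (no _)       (yes _)      isZ     = ≡.refl
        by-cases (no _)       (no z≢y)     isZ     = ⊥-elim (z≢y ≡.refl)
        by-cases (no _)       (yes z≡y)    (inH t) = ⊥-elim (elem≢z t (≡.sym z≡y))
        by-cases (no _)       (no _)       (inH t) = defaultAt-elem k t

      basis : IsBasis (toSubset B?)
      basis = (match , admits , injective) , ∣B∣
        where
        admits : ∀ y → y ∈ₛ toSubset B? → KinFamily r (match y) y
        admits y y∈ = let c = member (∈-toSubset⁻ B? y∈) in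
          ≡.subst (λ v → KinFamily r v y) (≡.sym (match≡label c)) (label-admits c)

        injective : ∀ y y′ → y ∈ₛ toSubset B? → y′ ∈ₛ toSubset B? → match y ≡ match y′ → y ≡ y′
        injective y y′ y∈ y′∈ eq =
          label-injective c c′ (≡.trans (≡.sym (match≡label c)) (≡.trans eq (match≡label c′)))
          where
          c  = member (∈-toSubset⁻ B? y∈)
          c′ = member (∈-toSubset⁻ B? y′∈)

    enumerate : Fin r → Fin (kinN r)
    enumerate zero             = x
    enumerate (suc zero)       = z
    enumerate (suc (suc t))    = elem k t

    enumerate-∈ : ∀ a → enumerate a ∈ B
    enumerate-∈ zero          = inj₂ (inj₁ ≡.refl)
    enumerate-∈ (suc zero)    = inj₂ (inj₂ ≡.refl)
    enumerate-∈ (suc (suc t)) = inj₁ (elem∈H t)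

    enumerate-injective : ∀ {a a′} → enumerate a ≡ enumerate a′ → a ≡ a′
    enumerate-injective {zero}          {zero}           _  = ≡.refl
    enumerate-injective {suc zero}      {suc zero}       _  = ≡.refl
    enumerate-injective {suc (suc t)}   {suc (suc t′)}   eq =
      ≡.cong (λ t → suc (suc t)) (proj₂ (elem-injective {k} {k} {t} {t′} eq))
    enumerate-injective {zero}          {suc zero}       eq = ⊥-elim (x≢z eq)
    enumerate-injective {suc zero}      {zero}           eq = ⊥-elim (x≢z (≡.sym eq))
    enumerate-injective {zero}          {suc (suc t′)}   eq = ⊥-elim (elem≢x t′ (≡.sym eq))
    enumerate-injective {suc zero}      {suc (suc t′)}   eq = ⊥-elim (elem≢z t′ (≡.sym eq))
    enumerate-injective {suc (suc t)}   {zero}           eq = ⊥-elim (elem≢x t eq)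
    enumerate-injective {suc (suc t)}   {suc zero}       eq = ⊥-elim (elem≢z t eq)

    B-avoids : ∀ {P} → Avoided k P → Avoids P x → Avoids P z → ∀ {y} → y ∈ B → Avoids P y
    B-avoids P-avoided x-avoids z-avoids (inj₁ y∈H)          = H-avoids y∈H P-avoided
    B-avoids P-avoided x-avoids z-avoids (inj₂ (inj₁ ≡.refl)) = x-avoids
    B-avoids P-avoided x-avoids z-avoids (inj₂ (inj₂ ≡.refl)) = z-avoids

    -- B has r elements, but only r - 1 of the r + 1 sets of the family can serve them
    not-M-independent : ∀ {B′ : Subset (kinN r)} → toSubset B? ⊆ₛ B′ → ∀ {P₁ P₂} → P₁ ≢ P₂ →
      (∀ {y} → y ∈ B → Avoids P₁ y × Avoids P₂ y) → ¬ M-Indep r B′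
    not-M-independent {B′} B⊆B′ {P₁} {P₂} P₁≢P₂ avoids (σ , admits , injective) =
      pigeonhole-avoiding-two (encode ∘ σ ∘ enumerate) (P₁≢P₂ ∘ encode-injective P₁ P₂)
        (λ a → proj₁ (avoids (enumerate-∈ a)) _ (admits′ a) ∘ encode-injective (σ (enumerate a)) P₁)
        (λ a → proj₂ (avoids (enumerate-∈ a)) _ (admits′ a) ∘ encode-injective (σ (enumerate a)) P₂)
        (λ {a} {a′} eq → enumerate-injective
                           (injective _ _ (∈B′ a) (∈B′ a′) (encode-injective (σ (enumerate a)) (σ (enumerate a′)) eq)))
        ℕ.≤-refl
      where
      ∈B′ : ∀ a → enumerate a ∈ₛ B′
      ∈B′ a = B⊆B′ (∈-toSubset⁺ B? (enumerate-∈ a))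
      admits′ : ∀ a → KinFamily r (σ (enumerate a)) (enumerate a)
      admits′ a = admits (enumerate a) (∈B′ a)

    relax-dependent : ∀ {s P₁ P₂} → P₁ ≢ P₂ → Avoided k P₁ → Avoided k P₂ →
      Avoids P₁ x × Avoids P₂ x → Avoids P₁ z × Avoids P₂ z →
      ¬ (toSubset B? ⊆ₛ HsHr r s) → ¬ KinRelax-Indep r s (toSubset B?)
    relax-dependent P₁≢P₂ P₁-avoided P₂-avoided (x-avoids₁ , x-avoids₂) (z-avoids₁ , z-avoids₂) B⊈HsHr = λ where
      (_ , inj₂ ≡.refl , B⊆HsHr)            → B⊈HsHr B⊆HsHr
      (_ , inj₁ ((independent , _) , _) , B⊆B′) → not-M-independent B⊆B′ P₁≢P₂
        (λ y∈B → B-avoids P₁-avoided x-avoids₁ z-avoids₁ y∈B , B-avoids P₂-avoided x-avoids₂ z-avoids₂ y∈B)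
        independent

    ⊆HsHr⇒≡ : ∀ {s} → toSubset B? ⊆ₛ HsHr r s → k ≡ s
    ⊆HsHr⇒≡ B⊆HsHr = ∈HsHr⇒≡ (elem∈H zero) (B⊆HsHr (∈-toSubset⁺ B? (inj₁ (elem∈H zero))))

  module Representation {c ℓ} (F : Field c ℓ) (s : Fin m) {n} (φ : Fin (kinN r) → Fin n → Field.Carrier F)
    (represents : ∀ X → (KinRelax-Indep r s X → LinIndep F φ X) × (LinIndep F φ X → KinRelax-Indep r s X)) where

    open LinearAlgebra F

    independent : ∀ {Q : Pred (Fin (kinN r)) 0ℓ} (Q? : Decidable Q) →
                  KinRelax-Indep r s (toSubset Q?) → Independent φ Q
    independent Q? ind =
      Independent-mono φ (∈-toSubset⁺ Q?) (proj₁ (LinIndep⇔Independent φ _) (proj₁ (represents _) ind))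

    dependent : ∀ {Q : Pred (Fin (kinN r)) 0ℓ} (Q? : Decidable Q) →
                ¬ KinRelax-Indep r s (toSubset Q?) → ¬ Independent φ Q
    dependent Q? dep ind =
      dep (proj₂ (represents _) (proj₂ (LinIndep⇔Independent φ _) (Independent-mono φ (∈-toSubset⁻ Q?) ind)))

    open BlockCycle F φ H H? H-nonempty H-disjoint e f special∉H special∉H e≢f next s (1 + m₀)

    walk-avoids : ∀ k → k ≤ 1 + m₀ → walk k ≢ s
    walk-avoids k k≤ = iterate-≢ s (suc k) (s≤s z≤n) (s≤s k≤)

    walk-closes : next (walk (1 + m₀)) ≡ s
    walk-closes = iterate-period s

    walk-end≢start : walk (1 + m₀) ≢ walk 0
    walk-end≢start eq = iterate-≢ s (1 + m₀) (s≤s z≤n) (ℕ.n≤1+n _) (next-injective eq)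

    inj₁-≢ : ∀ {i j : Fin m} → i ≢ j → _≢_ {A = KinIdx r} (inj₁ i) (inj₁ j)
    inj₁-≢ i≢j ≡.refl = i≢j ≡.refl

    ∈next⇒∉ : ∀ {i x} → x ∈ H (next i) → x ∉ H i
    ∈next⇒∉ x∈Hj x∈Hi = next-≢ _ (H-disjoint x∈Hj x∈Hi)

    ∈⇒∉next : ∀ {i x} → x ∈ H i → x ∉ H (next i)
    ∈⇒∉next x∈Hi x∈Hj = ∈next⇒∉ x∈Hj x∈Hi

    ∈H⇒≢e : ∀ {i x} → x ∈ H i → x ≢ e
    ∈H⇒≢e x∈H ≡.refl = special∉H _ x∈H

    Hs∪ef-independent : Independent φ (H s ∪ ｛ e ｝ ∪ ｛ f ｝)
    Hs∪ef-independent = independent Hs∪ef? (_ , inj₂ ≡.refl , Hs∪ef⊆HsHr)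
      where
      Hs∪ef? : Decidable (H s ∪ ｛ e ｝ ∪ ｛ f ｝)
      Hs∪ef? = H? s ∪? (e ≟_) ∪? (f ≟_)
      Hs∪ef⊆HsHr : toSubset Hs∪ef? ⊆ₛ HsHr r s
      Hs∪ef⊆HsHr y∈ with ∈-toSubset⁻ Hs∪ef? y∈
      ... | inj₁ y∈Hs          = H⊆HsHr y∈Hs
      ... | inj₂ (inj₁ ≡.refl) = special∈HsHr zero
      ... | inj₂ (inj₂ ≡.refl) = special∈HsHr (suc zero)

    H∪ef-dependent : ∀ i → i ≢ s → ¬ Independent φ (H i ∪ ｛ e ｝ ∪ ｛ f ｝)
    H∪ef-dependent i i≢s = dependent B?
      (relax-dependent (inj₁-≢ (next-≢ i ∘ ≡.sym)) (inj₂ (inj₁ ≡.refl)) (inj₂ (inj₂ ≡.refl))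
        (special-avoids , special-avoids) (special-avoids , special-avoids) (i≢s ∘ ⊆HsHr⇒≡))
      where open BlockPlusTwo i (special∉H i) (special∉H i) e≢f

    H∪next∪e-independent : ∀ i {x} → x ∈ H (next i) → Independent φ (H i ∪ ｛ x ｝ ∪ ｛ e ｝)
    H∪next∪e-independent i x∈Hj = independent B? (relax-independent B? basis (λ y∈ → y∈))
      where
      open BlockPlusTwo i (∈next⇒∉ x∈Hj) (special∉H i) (∈H⇒≢e x∈Hj)
      open Matching (λ ()) (inj₂ (inj₁ ≡.refl)) (inj₁ ≡.refl)
             (H-admits x∈Hj (next-≢ i ∘ ≡.sym) (next²-≢ i ∘ ≡.sym)) family-special-𝒜′

    H∪next-dependent : ∀ i {x z} → x ∈ H (next i) → z ∈ H (next i) → x ≢ z →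
                       ¬ Independent φ (H i ∪ ｛ x ｝ ∪ ｛ z ｝)
    H∪next-dependent i x∈Hj z∈Hj x≢z = dependent B?
      (relax-dependent (λ ()) (inj₂ (inj₂ ≡.refl)) (inj₁ ≡.refl)
        (H-avoids x∈Hj (inj₂ (inj₁ ≡.refl)) , H-avoids x∈Hj (inj₁ ≡.refl))
        (H-avoids z∈Hj (inj₂ (inj₁ ≡.refl)) , H-avoids z∈Hj (inj₁ ≡.refl))
        (λ B⊆HsHr → next-≢ i (≡.trans (∈HsHr⇒≡ x∈Hj (B⊆HsHr (∈-toSubset⁺ B? (inj₂ (inj₁ ≡.refl)))))
                                     (≡.sym (⊆HsHr⇒≡ B⊆HsHr)))))
      where open BlockPlusTwo i (∈next⇒∉ x∈Hj) (∈next⇒∉ z∈Hj) x≢z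

    next∪H-independent : ∀ i {x} → x ∈ H i → Independent φ (H (next i) ∪ ｛ x ｝)
    next∪H-independent i {x} x∈Hi = independent Hj∪x? (relax-independent Hj∪x? basis Hj∪x⊆B)
      where
      open BlockPlusTwo (next i) (∈⇒∉next x∈Hi) (special∉H (next i)) (∈H⇒≢e x∈Hi)
      open Matching (λ ()) (inj₂ (inj₂ ≡.refl)) (inj₁ ≡.refl)
             (H-admits x∈Hi (next²-≢ i) (next-≢ (next i))) family-special-𝒜′
      Hj∪x? : Decidable (H (next i) ∪ ｛ x ｝)
      Hj∪x? = H? (next i) ∪? (x ≟_)
      Hj∪x⊆B : toSubset Hj∪x? ⊆ₛ toSubset B?
      Hj∪x⊆B = ∈-toSubset⁺ B? ∘ [ inj₁ , inj₂ ∘ inj₁ ]′ ∘ ∈-toSubset⁻ Hj∪x?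

    next∪H-dependent : ∀ i {x z} → x ∈ H i → z ∈ H i → x ≢ z →
                       ¬ Independent φ (H (next i) ∪ ｛ x ｝ ∪ ｛ z ｝)
    next∪H-dependent i x∈Hi z∈Hi x≢z = dependent B?
      (relax-dependent (λ ()) (inj₂ (inj₁ ≡.refl)) (inj₁ ≡.refl)
        (H-avoids x∈Hi (inj₂ (inj₂ ≡.refl)) , H-avoids x∈Hi (inj₁ ≡.refl))
        (H-avoids z∈Hi (inj₂ (inj₂ ≡.refl)) , H-avoids z∈Hi (inj₁ ≡.refl))
        (λ B⊆HsHr → next-≢ i (≡.trans (⊆HsHr⇒≡ B⊆HsHr)
                               (≡.sym (∈HsHr⇒≡ x∈Hi (B⊆HsHr (∈-toSubset⁺ B? (inj₂ (inj₁ ≡.refl)))))))))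
      where open BlockPlusTwo (next i) (∈⇒∉next x∈Hi) (∈⇒∉next z∈Hi) x≢z

    Hs∪ends-independent : ∀ {x y} → x ∈ H (walk (1 + m₀)) → y ∈ H (walk 0) →
                          Independent φ (H s ∪ ｛ x ｝ ∪ ｛ y ｝)
    Hs∪ends-independent {x} {y} x∈Hu y∈Hw = independent B? (relax-independent B? basis (λ y∈ → y∈))
      where
      x∉Hs : x ∉ H s
      x∉Hs x∈Hs = walk-avoids (1 + m₀) ℕ.≤-refl (H-disjoint x∈Hu x∈Hs)
      y∉Hs : y ∉ H s
      y∉Hs y∈Hs = next-≢ s (H-disjoint y∈Hw y∈Hs)
      x≢y : x ≢ y
      x≢y ≡.refl = walk-end≢start (H-disjoint x∈Hu y∈Hw)
      open BlockPlusTwo s x∉Hs y∉Hs x≢y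
      open Matching (inj₁-≢ (next-≢ s)) (inj₂ (inj₂ ≡.refl)) (inj₂ (inj₁ ≡.refl))
             (H-admits x∈Hu (walk-end≢start ∘ ≡.sym) (λ w≡next-u → next-≢ s (≡.trans w≡next-u walk-closes)))
             (H-admits y∈Hw (next-≢ s ∘ ≡.sym) (next²-≢ s ∘ ≡.sym))

    dependencies : Dependencies
    dependencies = record
      { Hs∪ef-independent    = Hs∪ef-independent
      ; H∪ef-dependent       = H∪ef-dependent
      ; H∪next∪e-independent = H∪next∪e-independent
      ; H∪next-dependent     = H∪next-dependent
      ; next∪H-independent   = next∪H-independent
      ; next∪H-dependent     = next∪H-dependent
      ; Hs∪ends-independent  = Hs∪ends-independent
      }

    unrepresentable : ⊥
    unrepresentable = inconsistent walk-avoids walk-closes walk-end≢start dependencies (λ ())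

proposition4p5 : (r : ℕ) → 4 ≤ r → (s : Fin (r ∸ 1)) →
    {c ℓ : Level} (F : Field c ℓ) → ¬ Representable F (KinRelax-Indep r s)
proposition4p5 _ (s≤s (s≤s (s≤s (s≤s (z≤n {m₀}))))) s F (_ , φ , represents) =
  Kinser.Representation.unrepresentable m₀ F s φ represents
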